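{- Let $e\geq 2$ be an integer. Let $K$ be a finite commutative ring with identity having precisely three ideals: $\langle 0\rangle$, $J$ and $K$. Let $K/J\cong \mathbb{F}_q$, where $\mathbb{F}_q$ is a finite field of order $q$ for a prime power $q$. Then the graph $X(2e,K)$ is a divisible design graph with parameters $(v,k,\lambda_1,\lambda_2,m,n)$ where $v=\frac{q^{2e-1}(q^{2e}-1)}{q-1}$, $k=q^{4e-2}+q^{4e-3}-q^{2e-2}$, $\lambda_1=q^{4e-2}+q^{4e-3}-q^{4e-4}-q^{2e-2}$, $\lambda_2=q^{4e-2}+q^{4e-3}-q^{4e-4}-q^{4e-5}-q^{2e-2}+q^{2e-3}$, $m=\frac{q^{2e}-1}{q-1}$, $n=q^{2e-1}$.
   Context: A divisible design graph with parameters $(v,k,\lambda_1,\lambda_2,m,n)$ is a $k$-regular graph on $v$ vertices whose vertex set can be partitioned into $m$ classes of size $n$ such that any two distinct vertices in the same class have exactly $\lambda_1$ common neighbours and any two vertices in different classes have exactly $\lambda_2$ common neighbours. Let $K^\times$ be the set of units of $K$. Let $V'$ be the set of tuples $(a_1,\ldots,a_{2e})\in K^{2e}$ having at least one entry in $K^\times$. Two tuples $a,b\in V'$ are equivalent if $a=\lambda b$ for some $\lambda\in K^\times$; write $[a]$ for the class of $a$ and let $V$ be the set of classes. For $a,b\in K^{2e}$ put $\langle a,b\rangle=\sum_{i=1}^{e}(a_ib_{e+i}-a_{e+i}b_i)$ (i.e. $aMb^t$ with $M=\begin{bmatrix}0&I_e\\-I_e&0\end{bmatrix}$). The graph $X(2e,K)$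 has vertex set $V$, with $[a]$ adjacent to $[b]$ iff $\langle a,b\rangle\in K\setminus\{0\}$. -}

module Defs where

open import Level using (Level; _⊔_) renaming (zero to lzero)
open import Data.Nat using (ℕ; zero; suc) renaming (_+_ to _+ℕ_)
open import Data.Nat.DivMod using (_/_)
open import Data.Fin using (Fin; _↑ˡ_; _↑ʳ_)
open import Data.Product using (Σ; ∃; _×_; _,_; proj₁; proj₂)
open import Data.Sum using (_⊎_)
open import Data.Unit.Polymorphic using (⊤)
open import Relation.Nullary using (¬_)
open import Relation.Binary.PropositionalEquality using (_≡_)
open import Algebra.Bundles using (CommutativeRing)

private variable a r p c ℓ : Level

-- Natural-number division, with the (never used here) convention x div 0 = 0.
_div_ : ℕ → ℕ → ℕ
x div zero = 0
x div suc n = x / suc n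

-- Counting: "the number of _~_-classes of elements of A satisfying P is n",
-- witnessed by a map to Fin n which is well defined, injective and
-- surjective on classes.

record Count {A : Set a} (_~_ : A → A → Set r) (P : A → Set p) (n : ℕ)
             : Set (a ⊔ r ⊔ p) where
  field
    f    : Σ A P → Fin n
    resp : ∀ x y → proj₁ x ~ proj₁ y → f x ≡ f y
    inj  : ∀ x y → f x ≡ f y → proj₁ x ~ proj₁ y
    surj : ∀ i → ∃ λ x → f x ≡ i

record IsDDG {A : Set a} (_~_ : A → A → Set r) (Adj : A → A → Set p)
             (v k λ₁ λ₂ m n : ℕ) : Set (a ⊔ r ⊔ p) where
  field
    adj-sym   : ∀ x y → Adj x y → Adj y x
    adj-irr   : ∀ x → ¬ Adj x x
    order     : Count _~_ (λ _ → ⊤ {ℓ = Level.zero}) v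
    regular   : ∀ x → Count _~_ (Adj x) k
    cls       : A → Fin m
    cls-resp  : ∀ x y → x ~ y → cls x ≡ cls y
    cls-size  : ∀ i → Count _~_ (λ x → cls x ≡ i) n
    same-cls  : ∀ x y → ¬ (x ~ y) → cls x ≡ cls y →
                Count _~_ (λ z → Adj x z × Adj y z) λ₁
    diff-cls  : ∀ x y → ¬ (cls x ≡ cls y) →
                Count _~_ (λ z → Adj x z × Adj y z) λ₂

module _ (R : CommutativeRing c ℓ) where
  open CommutativeRing R

  IsUnit : Carrier → Set (c ⊔ ℓ)
  IsUnit x = ∃ λ y → x * y ≈ 1#

  HasSize : ℕ → Set (c ⊔ ℓ)
  HasSize N = Count _≈_ (λ _ → ⊤ {ℓ = lzero}) N

  record IsIdeal (I : Carrier → Set ℓ) : Set (c ⊔ ℓ) where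
    field
      resp  : ∀ {x y} → x ≈ y → I x → I y
      zero∈ : I 0#
      +∈    : ∀ {x y} → I x → I y → I (x + y)
      neg∈  : ∀ {x} → I x → I (- x)
      *∈    : ∀ r {x} → I x → I (r * x)

  _≐_ : (I I' : Carrier → Set ℓ) → Set (c ⊔ ℓ)
  I ≐ I' = ∀ x → (I x → I' x) × (I' x → I x)

  ZeroIdeal : Carrier → Set ℓ
  ZeroIdeal x = x ≈ 0#

  WholeRing : Carrier → Set ℓ
  WholeRing _ = ⊤

  ExactlyThreeIdeals : (J : Carrier → Set ℓ) → Set (c ⊔ Level.suc ℓ)
  ExactlyThreeIdeals J =
    IsIdeal J × ¬ (J ≐ ZeroIdeal) × ¬ (J ≐ WholeRing) ×
    (∀ I → IsIdeal I → (I ≐ ZeroIdeal) ⊎ (I ≐ J) ⊎ (I ≐ WholeRing))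

  -- the quotient R/J (congruence x ≡ y mod J) has q elements
  QuotientSize : (J : Carrier → Set ℓ) → ℕ → Set (c ⊔ ℓ)
  QuotientSize J q = Count (λ x y → J (x - y)) (λ _ → ⊤ {ℓ = lzero}) q

  Sum : ∀ {n} → (Fin n → Carrier) → Carrier
  Sum {zero}  g = 0#
  Sum {suc n} g = g Fin.zero + Sum (λ i → g (Fin.suc i))
    where import Data.Fin as Fin

  symp : (e : ℕ) → (Fin (e +ℕ e) → Carrier) → (Fin (e +ℕ e) → Carrier) → Carrier
  symp e a b = Sum {e} (λ i → a (i ↑ˡ e) * b (e ↑ʳ i) - a (e ↑ʳ i) * b (i ↑ˡ e))

  Unimodular : (e : ℕ) → (Fin (e +ℕ e) → Carrier) → Set (c ⊔ ℓ)
  Unimodular e a = ∃ λ i → IsUnit (a i)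

  V' : ℕ → Set (c ⊔ ℓ)
  V' e = Σ (Fin (e +ℕ e) → Carrier) (Unimodular e)

  _∼V_ : ∀ {e} → V' e → V' e → Set (c ⊔ ℓ)
  _∼V_ {e} (a , _) (b , _) = ∃ λ u → IsUnit u × (∀ i → a i ≈ u * b i)

  AdjX : ∀ {e} → V' e → V' e → Set ℓ
  AdjX {e} (a , _) (b , _) = ¬ (symp e a b ≈ 0#)

-- K is a local ring whose maximal ideal J = t K satisfies J² = 0; multiplication by t identifies
-- K / J with J, so |J| = q and |K| = q².  If a is unimodular and w is not congruent to a multiple
-- of a modulo J, some 2 × 2 minor of (a M, w M) is a unit, and Cramer's rule gives z₀, z₁ with
-- ⟪a,z₀⟫ = ⟪w,z₁⟫ = 1 and ⟪a,z₁⟫ = ⟪w,z₀⟫ = 0.  Then z ↦ (⟪a,z⟫, ⟪w,z⟫, z - ⟪a,z⟫ z₀ - ⟪w,z⟫ z₁)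
-- identifies K²ᵉ with K² × {a, w}⊥ and J²ᵉ with J² × ({a, w}⊥ ∩ J²ᵉ), so the number of unimodular
-- z for which (⟪a,z⟫, ⟪w,z⟫) satisfies a given condition is (admissible pairs in K²) |{a, w}⊥| minus
-- (admissible pairs in J²) |{a, w}⊥ ∩ J²ᵉ|; dividing by |K^×| = q (q - 1) counts points.
-- For the degree any w independent of a will do; two points in different classes are themselves
-- independent; and two inequivalent points of the same class satisfy b = u a + t w with u a unit and
-- w independent of a, so that ⟪b,z⟫ = u ⟪a,z⟫ + t ⟪w,z⟫.  A class consists of the vectors s a + j
-- with s a unit modulo J and j ∈ J²ᵉ, that is q^(2e - 1) points.

{-# OPTIONS --safe #-}
module Submission where

open import Level using (Level; _⊔_) renaming (zero to lzero)
open import Data.Nat as ℕ using (ℕ; zero; suc)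
import Data.Nat
open import Data.Product using (Σ; ∃; _×_; _,_; proj₁; proj₂)
open import Data.Sum using (_⊎_; inj₁; inj₂; [_,_]′)
open import Data.Unit.Polymorphic using (⊤; tt)
open import Data.Empty using (⊥; ⊥-elim)
open import Relation.Nullary using (¬_; Dec; yes; no; ¬?)
open import Relation.Binary.Structures using (IsEquivalence)
import Relation.Binary.PropositionalEquality as ≡
open ≡ using (_≡_; _≢_)
open import Algebra.Bundles using (CommutativeRing)
open import Defs

Univ : ∀ {a} {A : Set a} → A → Set
Univ _ = ⊤

module Counting where

  open ≡ using (refl; sym; trans; cong; cong₂; subst)
  open Data.Nat using (_+_; _*_; _^_; _∸_)
  open import Data.Nat.Properties using (≤-antisym; ≤-refl; ≤-trans; ≤-reflexive; m≤n+m; suc-injective; m+n∸m≡n)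
  open import Data.Fin using (Fin; zero; suc; _↑ˡ_; _↑ʳ_; splitAt; join; combine; remQuot; punchOut)
  open import Data.Fin.Properties using
    ( ↑ˡ-injective; ↑ʳ-injective; splitAt-↑ˡ; splitAt-↑ʳ; join-splitAt; combine-injective
    ; combine-remQuot; injective⇒≤; ¬Fin0; 0≢1+n; punchOut-cong; punchOut-injective)
  import Data.Fin.Properties as Fin

  private variable
    a b r s p p′ : Level
    A : Set a
    B : Set b
    R : A → A → Set r
    S : B → B → Set s
    P : A → Set p
    Q : A → Set p′
    n m : ℕ

  count-≤ : {A : Set a} {R : A → A → Set r} {P : A → Set p} {n m : ℕ} → Count R P n → Count R P m → n ℕ.≤ m
  count-≤ {A = A} {P = P} {n = n} c d = injective⇒≤ λ {i} {j} eq →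
    trans (sym (proj₂ (C.surj i))) (trans (C.resp (pick i) (pick j) (D.inj (pick i) (pick j) eq)) (proj₂ (C.surj j)))
    where
    module C = Count c
    module D = Count d
    pick : Fin n → Σ A P
    pick i = proj₁ (C.surj i)

  count-unique : Count R P n → Count R P m → n ≡ m
  count-unique c d = ≤-antisym (count-≤ c d) (count-≤ d c)

  count-nonempty : Count R P n → ∀ x → P x → 1 ℕ.≤ n
  count-nonempty {n = zero}  c x px = ⊥-elim (¬Fin0 (Count.f c (x , px)))
  count-nonempty {n = suc n} c x px = ℕ.s≤s ℕ.z≤n

  count-decidable : Count R P n → (x y : Σ A P) → Dec (R (proj₁ x) (proj₁ y))
  count-decidable c x y with Count.f c x Fin.≟ Count.f c y
  ... | yes e = yes (Count.inj c x y e)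
  ... | no ne = no (λ r → ne (Count.resp c x y r))

  count-bijection : {Q : B → Set p′} (F : Σ A P → Σ B Q) →
    (∀ x y → R (proj₁ x) (proj₁ y) → S (proj₁ (F x)) (proj₁ (F y))) →
    (∀ x y → S (proj₁ (F x)) (proj₁ (F y)) → R (proj₁ x) (proj₁ y)) →
    (∀ y → ∃ λ x → S (proj₁ (F x)) (proj₁ y)) →
    Count S Q n → Count R P n
  count-bijection F F-resp F-refl F-surj c = record
    { f    = λ x → C.f (F x)
    ; resp = λ x y r → C.resp _ _ (F-resp x y r)
    ; inj  = λ x y e → F-refl x y (C.inj _ _ e)
    ; surj = λ i → let (y , fy) = C.surj i ; (x , Fx~y) = F-surj y in
        x , trans (C.resp _ _ Fx~y) fy
    }
    where module C = Count c

  count-⇔ : (∀ x → R x x) → (∀ x → Q x → P x) → (∀ x → P x → Q x) → Count R P n → Count R Q n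
  count-⇔ refl′ Q⇒P P⇒Q = count-bijection (λ (x , qx) → x , Q⇒P x qx) (λ _ _ r → r) (λ _ _ r → r)
    (λ (x , px) → (x , P⇒Q x px) , refl′ x)

  count-singleton : IsEquivalence R → (x : A) → Count R (R x) 1
  count-singleton isEq x = record
    { f    = λ _ → zero
    ; resp = λ _ _ _ → refl
    ; inj  = λ (y , xy) (z , xz) _ → IsEquivalence.trans isEq (IsEquivalence.sym isEq xy) xz
    ; surj = λ { zero → (x , IsEquivalence.refl isEq) , refl }
    }

  ↑ˡ≢↑ʳ : ∀ (i : Fin n) (j : Fin m) → i ↑ˡ m ≢ n ↑ʳ j
  ↑ˡ≢↑ʳ {n} {m} i j eq with trans (sym (splitAt-↑ˡ n i m)) (trans (cong (splitAt n) eq) (splitAt-↑ʳ n m j))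
  ... | ()

  count-⊎ : Count R P n → Count R Q m →
    (∀ x y → R x y → P x → Q y → ⊥) → (∀ x y → R x y → Q x → P y → ⊥) →
    Count R (λ x → P x ⊎ Q x) (n + m)
  count-⊎ {R = R} {P = P} {n = n} {Q = Q} {m = m} c d P#Q Q#P = record { f = f ; resp = resp ; inj = inj ; surj = surj }
    where
    module C = Count c
    module D = Count d
    f : Σ _ (λ x → P x ⊎ Q x) → Fin (n + m)
    f (x , inj₁ px) = C.f (x , px) ↑ˡ m
    f (x , inj₂ qx) = n ↑ʳ D.f (x , qx)
    resp : ∀ x y → R (proj₁ x) (proj₁ y) → f x ≡ f y
    resp (x , inj₁ px) (y , inj₁ py) r = cong (_↑ˡ m) (C.resp _ _ r)
    resp (x , inj₁ px) (y , inj₂ qy) r = ⊥-elim (P#Q x y r px qy)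
    resp (x , inj₂ qx) (y , inj₁ py) r = ⊥-elim (Q#P x y r qx py)
    resp (x , inj₂ qx) (y , inj₂ qy) r = cong (n ↑ʳ_) (D.resp _ _ r)
    inj : ∀ x y → f x ≡ f y → R (proj₁ x) (proj₁ y)
    inj (x , inj₁ px) (y , inj₁ py) e = C.inj _ _ (↑ˡ-injective m _ _ e)
    inj (x , inj₁ px) (y , inj₂ qy) e = ⊥-elim (↑ˡ≢↑ʳ _ _ e)
    inj (x , inj₂ qx) (y , inj₁ py) e = ⊥-elim (↑ˡ≢↑ʳ _ _ (sym e))
    inj (x , inj₂ qx) (y , inj₂ qy) e = D.inj _ _ (↑ʳ-injective n _ _ e)
    surj-split : ∀ {i} s → join n m s ≡ i → ∃ λ x → f x ≡ i
    surj-split (inj₁ j) eq = let ((x , px) , fx) = C.surj j in (x , inj₁ px) , trans (cong (_↑ˡ m) fx) eq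
    surj-split (inj₂ j) eq = let ((x , qx) , fx) = D.surj j in (x , inj₂ qx) , trans (cong (n ↑ʳ_) fx) eq
    surj : ∀ i → ∃ λ x → f x ≡ i
    surj i = surj-split (splitAt n i) (join-splitAt n m i)

  count-× : {Q : B → Set p′} → Count R P n → Count S Q m →
    Count (λ x y → R (proj₁ x) (proj₁ y) × S (proj₂ x) (proj₂ y)) (λ x → P (proj₁ x) × Q (proj₂ x)) (n * m)
  count-× {n = n} {m = m} c d = record
    { f    = λ ((x , y) , (px , qy)) → combine (C.f (x , px)) (D.f (y , qy))
    ; resp = λ _ _ (r , s) → cong₂ combine (C.resp _ _ r) (D.resp _ _ s)
    ; inj  = λ _ _ e → let (e₁ , e₂) = combine-injective _ _ _ _ e in C.inj _ _ e₁ , D.inj _ _ e₂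
    ; surj = λ i → let (j , k) = remQuot {n} m i ; ((x , px) , fx) = C.surj j ; ((y , qy) , fy) = D.surj k in
        ((x , y) , (px , qy)) , trans (cong₂ combine fx fy) (combine-remQuot {n} m i)
    }
    where
    module C = Count c
    module D = Count d

  count-Fin→ : (∀ x → R x x) → Count R P n → (k : ℕ) →
    Count {A = Fin k → A} (λ v w → ∀ i → R (v i) (w i)) (λ v → ∀ i → P (v i)) (n ^ k)
  count-Fin→ refl′ c zero = record
    { f = λ _ → zero ; resp = λ _ _ _ → refl ; inj = λ _ _ _ ()
    ; surj = λ { zero → ((λ ()) , (λ ())) , refl } }
  count-Fin→ {A = A} {R = R} {P = P} refl′ c (suc k) =
    count-bijection uncons
      (λ _ _ r → r zero , (λ i → r (suc i)))
      (λ { _ _ (r₀ , rs) zero → r₀ ; _ _ (r₀ , rs) (suc i) → rs i })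
      (λ ((x , w) , (px , pw)) → (x ∷ w , λ { zero → px ; (suc i) → pw i }) , refl′ x , (λ i → refl′ (w i)))
      (count-× c (count-Fin→ refl′ c k))
    where
    open import Data.Vec.Functional using (_∷_; head; tail)
    uncons : Σ (Fin (suc k) → A) (λ v → ∀ i → P (v i)) → Σ (A × (Fin k → A)) (λ x → P (proj₁ x) × (∀ i → P (proj₂ x i)))
    uncons (v , pv) = (head v , tail v) , pv zero , (λ i → pv (suc i))

  count-fibres : (∀ x → R x x) →
    (cls : Σ A P → Fin m) → (∀ x y → R (proj₁ x) (proj₁ y) → cls x ≡ cls y) →
    (∀ i → Count R (λ y → Σ (P y) λ py → cls (y , py) ≡ i) n) →
    Count R P (m * n)
  count-fibres {A = A} {R = R} {P = P} {m = m} {n = n} refl′ cls cls-resp fibre =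
    record { f = f ; resp = resp ; inj = inj ; surj = surj }
    where
    g : (x : A) (px : P x) (i : Fin m) → cls (x , px) ≡ i → Fin (m * n)
    g x px i e = combine i (Count.f (fibre i) (x , px , e))
    f : Σ A P → Fin (m * n)
    f (x , px) = g x px (cls (x , px)) refl
    g-resp : ∀ x px y py i j (e : cls (x , px) ≡ i) (e′ : cls (y , py) ≡ j) → i ≡ j → R x y → g x px i e ≡ g y py j e′
    g-resp x px y py i .i e e′ refl r = cong (combine i) (Count.resp (fibre i) (x , px , e) (y , py , e′) r)
    g-inj : ∀ x px y py i j (e : cls (x , px) ≡ i) (e′ : cls (y , py) ≡ j) → g x px i e ≡ g y py j e′ → R x y
    g-inj x px y py i j e e′ eq with combine-injective i _ j _ eq
    ... | refl , eq₂ = Count.inj (fibre i) (x , px , e) (y , py , e′) eq₂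
    resp : ∀ x y → R (proj₁ x) (proj₁ y) → f x ≡ f y
    resp (x , px) (y , py) r = g-resp x px y py _ _ refl refl (cls-resp (x , px) (y , py) r) r
    inj : ∀ x y → f x ≡ f y → R (proj₁ x) (proj₁ y)
    inj (x , px) (y , py) eq = g-inj x px y py _ _ refl refl eq
    surj : ∀ k → ∃ λ x → f x ≡ k
    surj k = let (i , j) = remQuot {m} n k ; ((y , py , e) , fy) = Count.surj (fibre i) j in
      (y , py) , trans (g-resp y py y py _ i refl e e (refl′ y))
                   (trans (cong (combine i) fy) (combine-remQuot {m} n k))

  count-remove : Count R P (suc n) → Σ (Σ A P) λ x₀ → Count R (λ y → P y × ¬ R (proj₁ x₀) y) n
  count-remove {A = A} {R = R} {P = P} {n = n} c = x₀ , record { f = f ; resp = resp ; inj = inj ; surj = surj }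
    where
    module C = Count c
    x₀ : Σ A P
    x₀ = proj₁ (C.surj zero)
    fx₀≡0 : C.f x₀ ≡ zero
    fx₀≡0 = proj₂ (C.surj zero)
    0≢f : ∀ {y} (py : P y) → ¬ R (proj₁ x₀) y → zero ≢ C.f (y , py)
    0≢f py nr eq = nr (C.inj x₀ (_ , py) (trans fx₀≡0 eq))
    f : Σ A (λ y → P y × ¬ R (proj₁ x₀) y) → Fin n
    f (y , py , nr) = punchOut (0≢f py nr)
    resp : ∀ x y → R (proj₁ x) (proj₁ y) → f x ≡ f y
    resp _ _ r = punchOut-cong zero (C.resp _ _ r)
    inj : ∀ x y → f x ≡ f y → R (proj₁ x) (proj₁ y)
    inj (_ , py , nr) (_ , py′ , nr′) e = C.inj _ _ (punchOut-injective (0≢f py nr) (0≢f py′ nr′) e)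
    surj : ∀ j → ∃ λ x → f x ≡ j
    surj j = let ((y , py) , fy) = C.surj (suc j)
                 nr = λ r → 0≢1+n (trans (sym fx₀≡0) (trans (C.resp x₀ (y , py) r) fy))
             in (y , py , nr) , punchOut-cong zero {i≢k = λ ()} fy

  module _ {A : Set a} {R : A → A → Set r} (isEq : IsEquivalence R) where
    private module Eq = IsEquivalence isEq

    count-insert : {P : A → Set p} {n : ℕ} (x₀ : A) → P x₀ → (∀ y → P y → Dec (R x₀ y)) →
      Count R (λ y → P y × ¬ R x₀ y) n → Count R P (suc n)
    count-insert {P = P} {n = n} x₀ px₀ R? c = record { f = f ; resp = resp ; inj = inj ; surj = surj }
      where
      module C = Count c
      g : ∀ y → P y → Dec (R x₀ y) → Fin (suc n)
      g y py (yes _) = zero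
      g y py (no nr) = suc (C.f (y , py , nr))
      f : Σ A P → Fin (suc n)
      f (y , py) = g y py (R? y py)
      g-resp : ∀ y py d y′ py′ d′ → R y y′ → g y py d ≡ g y′ py′ d′
      g-resp y py (yes _)  y′ py′ (yes _)   r = refl
      g-resp y py (yes r₀) y′ py′ (no nr′)  r = ⊥-elim (nr′ (Eq.trans r₀ r))
      g-resp y py (no nr)  y′ py′ (yes r₀′) r = ⊥-elim (nr (Eq.trans r₀′ (Eq.sym r)))
      g-resp y py (no nr)  y′ py′ (no nr′)  r = cong suc (C.resp _ _ r)
      g-inj : ∀ y py d y′ py′ d′ → g y py d ≡ g y′ py′ d′ → R y y′
      g-inj y py (yes r₀) y′ py′ (yes r₀′) e = Eq.trans (Eq.sym r₀) r₀′
      g-inj y py (no nr)  y′ py′ (no nr′)  e = C.inj _ _ (Fin.suc-injective e)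
      g-inj y py (yes _)  y′ py′ (no _)   ()
      g-inj y py (no _)   y′ py′ (yes _)  ()
      resp : ∀ x y → R (proj₁ x) (proj₁ y) → f x ≡ f y
      resp (y , py) (y′ , py′) = g-resp y py _ y′ py′ _
      inj : ∀ x y → f x ≡ f y → R (proj₁ x) (proj₁ y)
      inj (y , py) (y′ , py′) = g-inj y py _ y′ py′ _
      g-x₀ : ∀ d → g x₀ px₀ d ≡ zero
      g-x₀ (yes _) = refl
      g-x₀ (no nr) = ⊥-elim (nr Eq.refl)
      g-other : ∀ y py nr d → g y py d ≡ suc (C.f (y , py , nr))
      g-other y py nr (yes r)  = ⊥-elim (nr r)
      g-other y py nr (no nr′) = cong suc (C.resp _ _ Eq.refl)
      surj : ∀ i → ∃ λ x → f x ≡ i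
      surj zero    = (x₀ , px₀) , g-x₀ _
      surj (suc j) = let ((y , py , nr) , fy) = C.surj j in (y , py) , trans (g-other y py nr _) (cong suc fy)

    count-subset : {P : A → Set p} {n : ℕ} → Count R P n → (Q : A → Set p′) → (∀ y → Dec (Q y)) →
      (∀ y y′ → R y y′ → Q y → Q y′) → ∃ λ k → Count R (λ y → P y × Q y) k
    count-subset {n = zero} c Q Q? Q-resp = 0 , record
      { f    = λ (y , py , _) → Count.f c (y , py)
      ; resp = λ (y , py , _) _ _ → ⊥-elim (¬Fin0 (Count.f c (y , py)))
      ; inj  = λ (y , py , _) _ _ → ⊥-elim (¬Fin0 (Count.f c (y , py)))
      ; surj = λ () }
    count-subset {n = suc n} c Q Q? Q-resp with count-remove c
    ... | ((x₀ , px₀) , c′) with count-subset c′ Q Q? Q-resp | Q? x₀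
    ... | (k , cQ) | yes qx₀ = suc k , count-insert x₀ (px₀ , qx₀)
            (λ y (py , _) → count-decidable c (x₀ , px₀) (y , py))
            (count-⇔ (λ _ → Eq.refl) (λ { y ((py , qy) , nr) → (py , nr) , qy }) (λ { y ((py , nr) , qy) → (py , qy) , nr }) cQ)
    ... | (k , cQ) | no ¬qx₀ = k , count-⇔ (λ _ → Eq.refl)
            (λ y (py , qy) → (py , (λ r → ¬qx₀ (Q-resp _ _ (Eq.sym r) qy))) , qy) (λ y ((py , _) , qy) → py , qy) cQ

    count-partition : {P : A → Set p} {n k : ℕ} → Count R P n → (Q : A → Set p′) → (∀ y → Dec (Q y)) →
      (∀ y y′ → R y y′ → Q y → Q y′) → Count R (λ y → P y × Q y) k →
      ∃ λ k′ → Count R (λ y → P y × ¬ Q y) k′ × k + k′ ≡ n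
    count-partition {P = P} c Q Q? Q-resp cQ =
      let (k′ , c¬Q) = count-subset c (λ y → ¬ Q y) (λ y → ¬? (Q? y)) (λ y y′ r ¬qy qy′ → ¬qy (Q-resp y′ y (Eq.sym r) qy′))
          c⊎ = count-⊎ cQ c¬Q (λ x y r (_ , qx) (_ , ¬qy) → ¬qy (Q-resp x y r qx))
                              (λ x y r (_ , ¬qx) (_ , qy) → ¬qx (Q-resp y x (Eq.sym r) qy))
          c⊎′ = count-⇔ (λ _ → Eq.refl) (λ _ → [ proj₁ , proj₁ ]′) (λ y py → split y py (Q? y)) c
      in k′ , c¬Q , count-unique c⊎ c⊎′
      where
      split : ∀ y → P y → Dec (Q y) → (P y × Q y) ⊎ (P y × ¬ Q y)
      split y py (yes qy) = inj₁ (py , qy)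
      split y py (no ¬qy) = inj₂ (py , ¬qy)

    count-complement : {P : A → Set p} {n k : ℕ} → Count R P n → (Q : A → Set p′) → (∀ y → Dec (Q y)) →
      (∀ y y′ → R y y′ → Q y → Q y′) → Count R (λ y → P y × Q y) k →
      Count R (λ y → P y × ¬ Q y) (n ∸ k)
    count-complement {k = k} c Q Q? Q-resp cQ =
      let (k′ , c¬Q , k+k′≡n) = count-partition c Q Q? Q-resp cQ in
      subst (Count R _) (trans (sym (m+n∸m≡n k k′)) (cong (_∸ k) k+k′≡n)) c¬Q

  module _ {A : Set a} {R : A → A → Set r} {E : A → A → Set s} (isR : IsEquivalence R) (isE : IsEquivalence E)
    (R⇒E : ∀ {x y} → R x y → E x y) (E? : ∀ x y → Dec (E x y)) where
    private
      module ER = IsEquivalence isR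
      module EE = IsEquivalence isE

      count-quotient-bounded : ∀ {P : A → Set p} {n : ℕ} (s′ bound : ℕ) → Count R P n →
        (∀ x → P x → Count R (λ y → P y × E x y) (suc s′)) → n ℕ.≤ bound →
        ∃ λ m → Count E P m × m * suc s′ ≡ n
      count-quotient-bounded {n = zero} s′ bound c fibre _ = 0 , record
        { f = Count.f c ; resp = λ x _ _ → ⊥-elim (¬Fin0 (Count.f c x))
        ; inj = λ x _ _ → ⊥-elim (¬Fin0 (Count.f c x)) ; surj = λ () } , refl
      count-quotient-bounded {P = P} {n = suc n} s′ (suc bound) c fibre (ℕ.s≤s n≤bound) =
        let ((x₀ , px₀) , _) = count-remove c
            (k , c′ , k+s≡n) = count-partition isR c (E x₀) (E? x₀) (λ y y′ r e → EE.trans e (R⇒E r)) (fibre x₀ px₀)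
            fibre′ : ∀ x → P x × ¬ E x₀ x → Count R (λ y → (P y × ¬ E x₀ y) × E x y) (suc s′)
            fibre′ x (px , ¬e) = count-⇔ (λ _ → ER.refl) (λ { y ((py , _) , e) → py , e })
                  (λ { y (py , e) → (py , (λ e₀ → ¬e (EE.trans e₀ (EE.sym e)))) , e }) (fibre x px)
            k≤bound = ≤-trans (m≤n+m k s′) (≤-trans (≤-reflexive (suc-injective k+s≡n)) n≤bound)
            (m , cE , m*s≡k) = count-quotient-bounded s′ bound c′ fibre′ k≤bound
        in suc m , count-insert isE x₀ px₀ (λ y _ → E? x₀ y) cE , trans (cong (suc s′ +_) m*s≡k) k+s≡n

    count-quotient : ∀ {P : A → Set p} {n : ℕ} (s′ : ℕ) → Count R P n →
      (∀ x → P x → Count R (λ y → P y × E x y) (suc s′)) →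
      ∃ λ m → Count E P m × m * suc s′ ≡ n
    count-quotient {n = n} s′ c fibre = count-quotient-bounded s′ n c fibre ≤-refl

-- The ring solver of the standard library needs a coefficient ring mapping into the carrier;
-- for an arbitrary commutative ring that is ℤ.
module IntegerCoefficientSolver {c ℓ} (K : CommutativeRing c ℓ) where

  open import Data.Integer as ℤ using (ℤ; +_; -[1+_]; _⊖_)
  import Data.Integer.Properties as ℤ
  open import Data.Sign as Sign using (Sign)
  open import Data.Maybe using (just; nothing)
  open import Relation.Nullary using (WeaklyDecidable)
  open import Algebra.Solver.Ring.AlmostCommutativeRing

  open CommutativeRing K
  open import Relation.Binary.Reasoning.Setoid setoid
  open import Algebra.Properties.CommutativeSemigroup *-commutativeSemigroup using (interchange)
  open import Algebra.Properties.Ring ring using (-‿involutive; -‿distribˡ-*; -0#≈0#; -‿anti-homo-+)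
  open import Algebra.Properties.Semiring.Mult.TCOptimised semiring using (×-homo-+; ×1-homo-*; 1+×) renaming (_×_ to _times_)

  fromℕ : ℕ → Carrier
  fromℕ n = n times 1#

  fromℤ : ℤ → Carrier
  fromℤ (+ n)      = fromℕ n
  fromℤ (-[1+ n ]) = - fromℕ (suc n)

  ⊖-homo : ∀ m n → fromℤ (m ⊖ n) ≈ fromℕ m - fromℕ n
  ⊖-homo zero    zero    = sym (-‿inverseʳ 0#)
  ⊖-homo zero    (suc n) = sym (+-identityˡ _)
  ⊖-homo (suc m) zero    = sym (trans (+-congˡ -0#≈0#) (+-identityʳ _))
  ⊖-homo (suc m) (suc n) = begin
    fromℤ (suc m ⊖ suc n)              ≡⟨ ≡.cong fromℤ (ℤ.[1+m]⊖[1+n]≡m⊖n m n) ⟩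
    fromℤ (m ⊖ n)                      ≈⟨ ⊖-homo m n ⟩
    fromℕ m - fromℕ n                ≈⟨ shift (fromℕ m) (fromℕ n) ⟩
    (1# + fromℕ m) - (1# + fromℕ n)  ≈⟨ sym (+-cong (1+× m 1#) (-‿cong (1+× n 1#))) ⟩
    fromℕ (suc m) - fromℕ (suc n)    ∎
    where
    shift : ∀ x y → x - y ≈ (1# + x) - (1# + y)
    shift x y = begin
      x - y                   ≈⟨ +-congʳ (sym (+-identityˡ x)) ⟩
      (0# + x) - y            ≈⟨ +-congʳ (+-congʳ (sym (-‿inverseʳ 1#))) ⟩
      ((1# - 1#) + x) - y     ≈⟨ +-assoc _ _ _ ⟩
      (1# - 1#) + (x - y)     ≈⟨ +-assoc _ _ _ ⟩
      1# + (- 1# + (x - y))   ≈⟨ +-congˡ (trans (sym (+-assoc _ _ _)) (trans (+-congʳ (+-comm _ _)) (+-assoc _ _ _))) ⟩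
      1# + (x + (- 1# - y))   ≈⟨ sym (+-assoc _ _ _) ⟩
      (1# + x) + (- 1# - y)   ≈⟨ +-congˡ (trans (sym (-‿anti-homo-+ y 1#)) (-‿cong (+-comm y 1#))) ⟩
      (1# + x) - (1# + y)     ∎

  fromSign : Sign → Carrier
  fromSign Sign.+ = 1#
  fromSign Sign.- = - 1#

  ◃-homo : ∀ s n → fromℤ (s ℤ.◃ n) ≈ fromSign s * fromℕ n
  ◃-homo s      zero    = sym (zeroʳ _)
  ◃-homo Sign.+ (suc n) = sym (*-identityˡ _)
  ◃-homo Sign.- (suc n) = trans (-‿cong (sym (*-identityˡ _))) (-‿distribˡ-* 1# _)

  sign-abs : ∀ i → fromℤ i ≈ fromSign (ℤ.sign i) * fromℕ (ℤ.∣ i ∣)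
  sign-abs (+ n)    = sym (*-identityˡ _)
  sign-abs -[1+ n ] = trans (-‿cong (sym (*-identityˡ _))) (-‿distribˡ-* 1# _)

  sign-homo : ∀ s t → fromSign (s Sign.* t) ≈ fromSign s * fromSign t
  sign-homo Sign.+ t      = sym (*-identityˡ _)
  sign-homo Sign.- Sign.+ = sym (*-identityʳ _)
  sign-homo Sign.- Sign.- = sym (trans (sym (-‿distribˡ-* 1# (- 1#))) (trans (-‿cong (*-identityˡ _)) (-‿involutive 1#)))

  +-homo : ∀ i j → fromℤ (i ℤ.+ j) ≈ fromℤ i + fromℤ j
  +-homo -[1+ m ] -[1+ n ] = begin
    - fromℕ (suc (suc (m ℕ.+ n)))            ≈⟨ -‿cong (trans (1+× (suc (m ℕ.+ n)) 1#) (+-congˡ (1+× (m ℕ.+ n) 1#))) ⟩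
    - (1# + (1# + fromℕ (m ℕ.+ n)))          ≈⟨ -‿cong (+-congˡ (+-congˡ (×-homo-+ 1# m n))) ⟩
    - (1# + (1# + (fromℕ m + fromℕ n)))     ≈⟨ -‿cong (regroup (fromℕ m) (fromℕ n)) ⟩
    - ((1# + fromℕ m) + (1# + fromℕ n))     ≈⟨ -‿anti-homo-+ _ _ ⟩
    - (1# + fromℕ n) + - (1# + fromℕ m)     ≈⟨ +-comm _ _ ⟩
    - (1# + fromℕ m) + - (1# + fromℕ n)     ≈⟨ sym (+-cong (-‿cong (1+× m 1#)) (-‿cong (1+× n 1#))) ⟩
    - fromℕ (suc m) + - fromℕ (suc n)       ∎
    where
    regroup : ∀ x y → 1# + (1# + (x + y)) ≈ (1# + x) + (1# + y)
    regroup x y = begin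
      1# + (1# + (x + y)) ≈⟨ +-congˡ (trans (sym (+-assoc _ _ _)) (trans (+-congʳ (+-comm _ _)) (+-assoc _ _ _))) ⟩
      1# + (x + (1# + y)) ≈⟨ sym (+-assoc _ _ _) ⟩
      (1# + x) + (1# + y) ∎
  +-homo -[1+ m ] (+ n)    = trans (⊖-homo n (suc m)) (+-comm _ _)
  +-homo (+ m)    -[1+ n ] = ⊖-homo m (suc n)
  +-homo (+ m)    (+ n)    = ×-homo-+ 1# m n

  *-homo : ∀ i j → fromℤ (i ℤ.* j) ≈ fromℤ i * fromℤ j
  *-homo i j = begin
    fromℤ (i ℤ.* j)
      ≈⟨ ◃-homo (ℤ.sign i Sign.* ℤ.sign j) (ℤ.∣ i ∣ ℕ.* ℤ.∣ j ∣) ⟩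
    fromSign (ℤ.sign i Sign.* ℤ.sign j) * fromℕ (ℤ.∣ i ∣ ℕ.* ℤ.∣ j ∣)
      ≈⟨ *-cong (sign-homo (ℤ.sign i) (ℤ.sign j)) (×1-homo-* ℤ.∣ i ∣ ℤ.∣ j ∣) ⟩
    (fromSign (ℤ.sign i) * fromSign (ℤ.sign j)) * (fromℕ (ℤ.∣ i ∣) * fromℕ (ℤ.∣ j ∣))
      ≈⟨ interchange _ _ _ _ ⟩
    (fromSign (ℤ.sign i) * fromℕ (ℤ.∣ i ∣)) * (fromSign (ℤ.sign j) * fromℕ (ℤ.∣ j ∣))
      ≈⟨ sym (*-cong (sign-abs i) (sign-abs j)) ⟩
    fromℤ i * fromℤ j ∎

  -‿homo : ∀ i → fromℤ (ℤ.- i) ≈ - fromℤ i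
  -‿homo -[1+ n ]    = sym (-‿involutive _)
  -‿homo (+ zero)    = sym -0#≈0#
  -‿homo (+ suc n)   = refl

  ℤ⟶K : ℤ.+-*-rawRing -Raw-AlmostCommutative⟶ fromCommutativeRing K
  ℤ⟶K = record
    { ⟦_⟧ = fromℤ ; +-homo = +-homo ; *-homo = *-homo ; -‿homo = -‿homo
    ; 0-homo = refl ; 1-homo = refl }

  ≟-homo : ∀ i j → WeaklyDecidable (fromℤ i ≈ fromℤ j)
  ≟-homo i j with i ℤ.≟ j
  ... | yes ≡.refl = just refl
  ... | no _     = nothing

  open import Algebra.Solver.Ring ℤ.+-*-rawRing (fromCommutativeRing K) ℤ⟶K ≟-homo public

module SymplecticForm {c ℓ} (K : CommutativeRing c ℓ) (e : ℕ) where

  open import Data.Fin as Fin using (Fin; _↑ˡ_; _↑ʳ_; splitAt)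
  import Data.Fin.Properties as Fin
  open CommutativeRing K
  open IntegerCoefficientSolver K using (solve; _:=_; _:+_; _:*_; _:-_; :-_; con)
  open import Relation.Binary.Reasoning.Setoid setoid

  Sum-cong : ∀ {n} {f g : Fin n → Carrier} → (∀ i → f i ≈ g i) → Sum K f ≈ Sum K g
  Sum-cong {zero}  f≈g = refl
  Sum-cong {suc n} f≈g = +-cong (f≈g Fin.zero) (Sum-cong (λ i → f≈g (Fin.suc i)))

  Sum-+ : ∀ {n} (f g : Fin n → Carrier) → Sum K (λ i → f i + g i) ≈ Sum K f + Sum K g
  Sum-+ {zero}  f g = sym (+-identityʳ 0#)
  Sum-+ {suc n} f g = trans (+-congˡ (Sum-+ (λ i → f (Fin.suc i)) (λ i → g (Fin.suc i))))
    (solve 4 (λ a b c d → (a :+ b) :+ (c :+ d) := (a :+ c) :+ (b :+ d)) refl _ _ _ _)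

  Sum-* : ∀ {n} x (f : Fin n → Carrier) → Sum K (λ i → x * f i) ≈ x * Sum K f
  Sum-* {zero}  x f = sym (zeroʳ x)
  Sum-* {suc n} x f = trans (+-congˡ (Sum-* x (λ i → f (Fin.suc i)))) (sym (distribˡ x _ _))

  Sum-zero : ∀ {n} (f : Fin n → Carrier) → (∀ i → f i ≈ 0#) → Sum K f ≈ 0#
  Sum-zero {zero}  f f≈0 = refl
  Sum-zero {suc n} f f≈0 = trans (+-cong (f≈0 Fin.zero) (Sum-zero _ (λ i → f≈0 (Fin.suc i)))) (+-identityˡ 0#)

  Sum-neg : ∀ {n} (f : Fin n → Carrier) → Sum K (λ i → - f i) ≈ - Sum K f
  Sum-neg f = begin
    Sum K (λ i → - f i)        ≈⟨ Sum-cong (λ i → solve 1 (λ x → :- x := (:- con (+ 1)) :* x) refl (f i)) ⟩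
    Sum K (λ i → - 1# * f i)   ≈⟨ Sum-* (- 1#) f ⟩
    - 1# * Sum K f             ≈⟨ solve 1 (λ x → (:- con (+ 1)) :* x := :- x) refl _ ⟩
    - Sum K f                  ∎
    where open import Data.Integer using (+_)

  Sum-single : ∀ {n} (f : Fin n → Carrier) (k : Fin n) → (∀ i → i ≢ k → f i ≈ 0#) → Sum K f ≈ f k
  Sum-single {suc n} f Fin.zero    f≈0 =
    trans (+-congˡ (Sum-zero _ (λ i → f≈0 (Fin.suc i) (λ ())))) (+-identityʳ _)
  Sum-single {suc n} f (Fin.suc k) f≈0 =
    trans (+-cong (f≈0 Fin.zero (λ ())) (Sum-single _ k (λ i i≢k → f≈0 (Fin.suc i) (λ eq → i≢k (Fin.suc-injective eq)))))
          (+-identityˡ _)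

  Sum-split : ∀ m n (f : Fin (m ℕ.+ n) → Carrier) → Sum K f ≈ Sum K (λ i → f (i ↑ˡ n)) + Sum K (λ i → f (m ↑ʳ i))
  Sum-split zero    n f = sym (+-identityˡ _)
  Sum-split (suc m) n f = trans (+-congˡ (Sum-split m n (λ i → f (Fin.suc i)))) (sym (+-assoc _ _ _))

  K²ᵉ : Set c
  K²ᵉ = Fin (e ℕ.+ e) → Carrier

  _≋_ : K²ᵉ → K²ᵉ → Set ℓ
  a ≋ b = ∀ i → a i ≈ b i

  ≋-isEquivalence : IsEquivalence _≋_
  ≋-isEquivalence = record { refl = λ i → refl ; sym = λ h i → sym (h i) ; trans = λ h g i → trans (h i) (g i) }

  ⟪_,_⟫ : K²ᵉ → K²ᵉ → Carrier
  ⟪ a , b ⟫ = symp K e a b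

  private
    term : K²ᵉ → K²ᵉ → Fin e → Carrier
    term a b i = a (i ↑ˡ e) * b (e ↑ʳ i) - a (e ↑ʳ i) * b (i ↑ˡ e)

  ⟪⟫-cong : ∀ {a a′ z z′} → a ≋ a′ → z ≋ z′ → ⟪ a , z ⟫ ≈ ⟪ a′ , z′ ⟫
  ⟪⟫-cong a≋a′ z≋z′ = Sum-cong (λ i → +-cong (*-cong (a≋a′ (i ↑ˡ e)) (z≋z′ (e ↑ʳ i)))
                                              (-‿cong (*-cong (a≋a′ (e ↑ʳ i)) (z≋z′ (i ↑ˡ e)))))

  ⟪⟫-congʳ : ∀ a {z z′} → z ≋ z′ → ⟪ a , z ⟫ ≈ ⟪ a , z′ ⟫
  ⟪⟫-congʳ a = ⟪⟫-cong {a} {a} (λ _ → refl)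

  ⟪⟫-antisym : ∀ a b → ⟪ a , b ⟫ ≈ - ⟪ b , a ⟫
  ⟪⟫-antisym a b = trans
    (Sum-cong (λ i → solve 4 (λ a₁ b₁ a₂ b₂ → a₁ :* b₁ :- a₂ :* b₂ := :- (b₂ :* a₂ :- b₁ :* a₁)) refl
                                (a (i ↑ˡ e)) (b (e ↑ʳ i)) (a (e ↑ʳ i)) (b (i ↑ˡ e))))
    (Sum-neg (term b a))

  ⟪⟫-alternating : ∀ a → ⟪ a , a ⟫ ≈ 0#
  ⟪⟫-alternating a = Sum-zero (term a a) (λ i → trans (+-congˡ (-‿cong (*-comm (a (e ↑ʳ i)) (a (i ↑ˡ e))))) (-‿inverseʳ _))

  ⟪⟫-+ʳ : ∀ a u v → ⟪ a , (λ k → u k + v k) ⟫ ≈ ⟪ a , u ⟫ + ⟪ a , v ⟫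
  ⟪⟫-+ʳ a u v = trans
    (Sum-cong (λ i → solve 6 (λ a₁ a₂ u₁ u₂ v₁ v₂ → a₁ :* (u₂ :+ v₂) :- a₂ :* (u₁ :+ v₁) := (a₁ :* u₂ :- a₂ :* u₁) :+ (a₁ :* v₂ :- a₂ :* v₁))
                              refl (a (i ↑ˡ e)) (a (e ↑ʳ i)) (u (i ↑ˡ e)) (u (e ↑ʳ i)) (v (i ↑ˡ e)) (v (e ↑ʳ i))))
    (Sum-+ (term a u) (term a v))

  ⟪⟫-*ʳ : ∀ a x u → ⟪ a , (λ k → x * u k) ⟫ ≈ x * ⟪ a , u ⟫
  ⟪⟫-*ʳ a x u = trans
    (Sum-cong (λ i → solve 5 (λ x a₁ a₂ u₁ u₂ → a₁ :* (x :* u₂) :- a₂ :* (x :* u₁) := x :* (a₁ :* u₂ :- a₂ :* u₁))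
                              refl x (a (i ↑ˡ e)) (a (e ↑ʳ i)) (u (i ↑ˡ e)) (u (e ↑ʳ i))))
    (Sum-* x (term a u))

  ⟪⟫-linearʳ : ∀ a x u y v → ⟪ a , (λ k → x * u k + y * v k) ⟫ ≈ x * ⟪ a , u ⟫ + y * ⟪ a , v ⟫
  ⟪⟫-linearʳ a x u y v = trans (⟪⟫-+ʳ a (λ k → x * u k) (λ k → y * v k)) (+-cong (⟪⟫-*ʳ a x u) (⟪⟫-*ʳ a y v))

  ⟪⟫-linearˡ : ∀ x u y v z → ⟪ (λ k → x * u k + y * v k) , z ⟫ ≈ x * ⟪ u , z ⟫ + y * ⟪ v , z ⟫
  ⟪⟫-linearˡ x u y v z = begin
    ⟪ (λ k → x * u k + y * v k) , z ⟫ ≈⟨ ⟪⟫-antisym (λ k → x * u k + y * v k) z ⟩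
    - ⟪ z , (λ k → x * u k + y * v k) ⟫ ≈⟨ -‿cong (⟪⟫-linearʳ z x u y v) ⟩
    - (x * ⟪ z , u ⟫ + y * ⟪ z , v ⟫) ≈⟨ solve 4 (λ x a y b → :- (x :* a :+ y :* b) := x :* (:- a) :+ y :* (:- b)) refl x _ y _ ⟩
    x * - ⟪ z , u ⟫ + y * - ⟪ z , v ⟫ ≈⟨ sym (+-cong (*-congˡ (⟪⟫-antisym u z)) (*-congˡ (⟪⟫-antisym v z))) ⟩
    x * ⟪ u , z ⟫ + y * ⟪ v , z ⟫ ∎
    where open import Data.Integer using (+_)

  dot : K²ᵉ → K²ᵉ → Carrier
  dot h z = Sum K (λ k → h k * z k)

  -- a ᴹ is the row vector a M, so that ⟪ a , z ⟫ = (a M) · z.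
  _ᴹ : K²ᵉ → K²ᵉ
  (a ᴹ) k = [ (λ i → - a (e ↑ʳ i)) , (λ i → a (i ↑ˡ e)) ]′ (splitAt e k)

  ᴹ-↑ˡ : ∀ a i → (a ᴹ) (i ↑ˡ e) ≡ - a (e ↑ʳ i)
  ᴹ-↑ˡ a i rewrite Fin.splitAt-↑ˡ e i e = ≡.refl

  ᴹ-↑ʳ : ∀ a i → (a ᴹ) (e ↑ʳ i) ≡ a (i ↑ˡ e)
  ᴹ-↑ʳ a i rewrite Fin.splitAt-↑ʳ e e i = ≡.refl

  ᴹ-+* : ∀ a x b → ((λ k → a k + x * b k) ᴹ) ≋ (λ k → (a ᴹ) k + x * (b ᴹ) k)
  ᴹ-+* a x b k with splitAt e k
  ... | inj₁ i = solve 3 (λ a x b → :- (a :+ x :* b) := (:- a) :+ x :* (:- b)) refl _ x _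
  ... | inj₂ i = refl

  ⟪⟫≈dot : ∀ a z → ⟪ a , z ⟫ ≈ dot (a ᴹ) z
  ⟪⟫≈dot a z = begin
    Sum K (λ i → a (i ↑ˡ e) * z (e ↑ʳ i) - a (e ↑ʳ i) * z (i ↑ˡ e))
      ≈⟨ Sum-+ (λ i → a (i ↑ˡ e) * z (e ↑ʳ i)) (λ i → - (a (e ↑ʳ i) * z (i ↑ˡ e))) ⟩
    Sum K (λ i → a (i ↑ˡ e) * z (e ↑ʳ i)) + Sum K (λ i → - (a (e ↑ʳ i) * z (i ↑ˡ e)))
      ≈⟨ +-comm _ _ ⟩
    Sum K (λ i → - (a (e ↑ʳ i) * z (i ↑ˡ e))) + Sum K (λ i → a (i ↑ˡ e) * z (e ↑ʳ i))
      ≈⟨ +-cong (Sum-cong (λ i → trans (-‿distribˡ-*′ _ _) (*-congʳ (reflexive (≡.sym (ᴹ-↑ˡ a i))))))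
                (Sum-cong (λ i → *-congʳ (reflexive (≡.sym (ᴹ-↑ʳ a i))))) ⟩
    Sum K (λ i → (a ᴹ) (i ↑ˡ e) * z (i ↑ˡ e)) + Sum K (λ i → (a ᴹ) (e ↑ʳ i) * z (e ↑ʳ i))
      ≈⟨ sym (Sum-split e e (λ k → (a ᴹ) k * z k)) ⟩
    dot (a ᴹ) z ∎
    where
    -‿distribˡ-*′ : ∀ x y → - (x * y) ≈ - x * y
    -‿distribˡ-*′ x y = solve 2 (λ x y → :- (x :* y) := (:- x) :* y) refl x y

  ε : Fin (e ℕ.+ e) → K²ᵉ
  ε m k with k Fin.≟ m
  ... | yes _ = 1#
  ... | no _  = 0#

  ε-diagonal : ∀ m → ε m m ≈ 1#
  ε-diagonal m with m Fin.≟ m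
  ... | yes _ = refl
  ... | no m≢m = ⊥-elim (m≢m ≡.refl)

  ε-off-diagonal : ∀ m k → k ≢ m → ε m k ≈ 0#
  ε-off-diagonal m k k≢m with k Fin.≟ m
  ... | yes k≡m = ⊥-elim (k≢m k≡m)
  ... | no _    = refl

  dot-ε : ∀ h m → dot h (ε m) ≈ h m
  dot-ε h m = trans (Sum-single _ m (λ i i≢m → trans (*-congˡ (ε-off-diagonal m i i≢m)) (zeroʳ _)))
                    (trans (*-congˡ (ε-diagonal m)) (*-identityʳ _))

module ThreeIdealRing {c ℓ} (K : CommutativeRing c ℓ) (N : ℕ) (K-finite : HasSize K N)
  (J : CommutativeRing.Carrier K → Set ℓ) (three : ExactlyThreeIdeals K J) where

  open import Data.Fin using (Fin)
  import Data.Fin.Properties as Fin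
  open CommutativeRing K
  open IntegerCoefficientSolver K using (solve; _:=_; _:+_; _:*_; _:-_; :-_; con)
  open import Relation.Binary.Reasoning.Setoid setoid
  open import Data.Integer using (+_)
  open Counting
  open import Relation.Nullary.Decidable using (_×-dec_)

  private
    J-isIdeal : IsIdeal K J
    J-isIdeal = proj₁ three
    J≉0 : ¬ _≐_ K J (ZeroIdeal K)
    J≉0 = proj₁ (proj₂ three)
    J≉K : ¬ _≐_ K J (WholeRing K)
    J≉K = proj₁ (proj₂ (proj₂ three))
    classify : ∀ I → IsIdeal K I → _≐_ K I (ZeroIdeal K) ⊎ _≐_ K I J ⊎ _≐_ K I (WholeRing K)
    classify = proj₂ (proj₂ (proj₂ three))

  open IsIdeal J-isIdeal public using () renaming (resp to J-resp; zero∈ to J-0#; +∈ to J-+; neg∈ to J-neg; *∈ to J-*ˡ)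

  J-*ʳ : ∀ r {x} → J x → J (x * r)
  J-*ʳ r jx = J-resp (*-comm r _) (J-*ˡ r jx)

  J-sub : ∀ {x y} → J x → J y → J (x - y)
  J-sub jx jy = J-+ jx (J-neg jy)

  J-≈0 : ∀ {x} → x ≈ 0# → J x
  J-≈0 x≈0 = J-resp (sym x≈0) J-0#

  _≈?_ : ∀ x y → Dec (x ≈ y)
  x ≈? y = count-decidable K-finite (x , tt) (y , tt)

  index : Carrier → Fin N
  index x = Count.f K-finite (x , tt)

  element : Fin N → Carrier
  element i = proj₁ (proj₁ (Count.surj K-finite i))

  element-index : ∀ x → element (index x) ≈ x
  element-index x = Count.inj K-finite _ (x , tt) (proj₂ (Count.surj K-finite (index x)))

  ∃? : ∀ {p} (Q : Carrier → Set p) → (∀ x → Dec (Q x)) → (∀ {x y} → x ≈ y → Q x → Q y) → Dec (∃ Q)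
  ∃? Q Q? Q-resp with Fin.any? (λ i → Q? (element i))
  ... | yes (i , qi) = yes (element i , qi)
  ... | no ¬q        = no (λ (x , qx) → ¬q (index x , Q-resp (sym (element-index x)) qx))

  Unit : Carrier → Set (c ⊔ ℓ)
  Unit = IsUnit K

  Unit? : ∀ x → Dec (Unit x)
  Unit? x = ∃? (λ y → x * y ≈ 1#) (λ y → (x * y) ≈? 1#) (λ y≈y′ xy≈1 → trans (*-congˡ (sym y≈y′)) xy≈1)

  Unit-resp : ∀ {x y} → x ≈ y → Unit x → Unit y
  Unit-resp x≈y (w , xw≈1) = w , trans (*-congʳ (sym x≈y)) xw≈1

  Unit-* : ∀ {x y} → Unit x → Unit y → Unit (x * y)
  Unit-* {x} {y} (a , xa≈1) (b , yb≈1) = a * b , (begin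
    x * y * (a * b)   ≈⟨ solve 4 (λ x y a b → x :* y :* (a :* b) := (x :* a) :* (y :* b)) refl x y a b ⟩
    (x * a) * (y * b) ≈⟨ *-cong xa≈1 yb≈1 ⟩
    1# * 1#           ≈⟨ *-identityˡ 1# ⟩
    1#                ∎)

  Unit-1# : Unit 1#
  Unit-1# = 1# , *-identityˡ 1#

  Unit-neg : ∀ {x} → Unit x → Unit (- x)
  Unit-neg {x} (w , xw≈1) = - w , trans (solve 2 (λ x w → (:- x) :* (:- w) := x :* w) refl x w) xw≈1

  Unit-inverse : ∀ {u} → Unit u → Σ Carrier λ w → Unit w × (w * u ≈ 1#)
  Unit-inverse {u} (w , uw≈1) = w , (u , trans (*-comm w u) uw≈1) , trans (*-comm w u) uw≈1

  Unit-cancelˡ : ∀ {u x y} → Unit u → u * x ≈ u * y → x ≈ y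
  Unit-cancelˡ {u} {x} {y} u-unit ux≈uy = let (w , _ , wu≈1) = Unit-inverse u-unit in begin
    x             ≈⟨ sym (trans (*-congʳ wu≈1) (*-identityˡ x)) ⟩
    (w * u) * x   ≈⟨ *-assoc _ _ _ ⟩
    w * (u * x)   ≈⟨ *-congˡ ux≈uy ⟩
    w * (u * y)   ≈⟨ sym (*-assoc _ _ _) ⟩
    (w * u) * y   ≈⟨ trans (*-congʳ wu≈1) (*-identityˡ y) ⟩
    y             ∎

  J⇒¬Unit : ∀ {x} → J x → ¬ Unit x
  J⇒¬Unit {x} jx (y , xy≈1) = J≉K (λ z → (λ _ → tt) , (λ _ → J-resp (*-identityʳ z) (J-*ˡ z J-1#)))
    where
    J-1# : J 1#
    J-1# = J-resp (trans (*-comm y x) xy≈1) (J-*ˡ y jx)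

  Unit⇒≉0 : ∀ {x} → Unit x → ¬ x ≈ 0#
  Unit⇒≉0 x-unit x≈0 = J⇒¬Unit (J-≈0 x≈0) x-unit

  -- Ideals live in Set ℓ, so the multiplier is quantified over indices in Fin N rather than over Carrier.
  principal : Carrier → Carrier → Set ℓ
  principal x y = Σ (Fin N) λ i → y ≈ element i * x

  principal-isIdeal : ∀ x → IsIdeal K (principal x)
  principal-isIdeal x = record
    { resp  = λ { y≈y′ (i , y≈ix) → i , trans (sym y≈y′) y≈ix }
    ; zero∈ = index 0# , sym (trans (*-congʳ (element-index 0#)) (zeroˡ x))
    ; +∈    = λ { (i , a≈) (j , b≈) → index (element i + element j) ,
                trans (+-cong a≈ b≈) (trans (sym (distribʳ x _ _)) (*-congʳ (sym (element-index _)))) }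
    ; neg∈  = λ { (i , a≈) → index (- element i) ,
                trans (-‿cong a≈) (trans (solve 2 (λ a x → :- (a :* x) := (:- a) :* x) refl _ _) (*-congʳ (sym (element-index _)))) }
    ; *∈    = λ { r (i , a≈) → index (r * element i) ,
                trans (*-congˡ a≈) (trans (sym (*-assoc _ _ _)) (*-congʳ (sym (element-index _)))) }
    }

  principal-self : ∀ x → principal x x
  principal-self x = index 1# , sym (trans (*-congʳ (element-index 1#)) (*-identityˡ x))

  principal-1#⇒Unit : ∀ {x} → principal x 1# → Unit x
  principal-1#⇒Unit {x} (i , 1≈ix) = element i , trans (*-comm x _) (sym 1≈ix)

  ¬Unit⇒J : ∀ {x} → ¬ Unit x → J x
  ¬Unit⇒J {x} ¬unit with classify (principal x) (principal-isIdeal x)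
  ... | inj₁ xK≐0        = J-≈0 (proj₁ (xK≐0 x) (principal-self x))
  ... | inj₂ (inj₁ xK≐J) = proj₁ (xK≐J x) (principal-self x)
  ... | inj₂ (inj₂ xK≐K) = ⊥-elim (¬unit (principal-1#⇒Unit (proj₂ (xK≐K 1#) tt)))

  J? : ∀ x → Dec (J x)
  J? x with Unit? x
  ... | yes unit = no (λ jx → J⇒¬Unit jx unit)
  ... | no ¬unit = yes (¬Unit⇒J ¬unit)

  ¬J⇒Unit : ∀ {x} → ¬ J x → Unit x
  ¬J⇒Unit {x} ¬jx with Unit? x
  ... | yes unit = unit
  ... | no ¬unit = ⊥-elim (¬jx (¬Unit⇒J ¬unit))

  Unit-+J : ∀ {u j} → Unit u → J j → Unit (u + j)
  Unit-+J {u} {j} u-unit jj = ¬J⇒Unit (λ ju+j →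
    J⇒¬Unit (J-resp (solve 2 (λ u j → (u :+ j) :- j := u) refl u j) (J-sub ju+j jj)) u-unit)

  times-J : Carrier → Carrier → Set ℓ
  times-J x z = Σ (Fin N) λ i → J (element i) × z ≈ x * element i

  times-J-isIdeal : ∀ x → IsIdeal K (times-J x)
  times-J-isIdeal x = record
    { resp  = λ { z≈z′ (i , ji , z≈) → i , ji , trans (sym z≈z′) z≈ }
    ; zero∈ = index 0# , J-resp (sym (element-index 0#)) J-0# , sym (trans (*-congˡ (element-index 0#)) (zeroʳ x))
    ; +∈    = λ { (i , ji , a≈) (j , jj , b≈) → index (element i + element j) , J-resp (sym (element-index _)) (J-+ ji jj) ,
                trans (+-cong a≈ b≈) (trans (sym (distribˡ x _ _)) (*-congˡ (sym (element-index _)))) }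
    ; neg∈  = λ { (i , ji , a≈) → index (- element i) , J-resp (sym (element-index _)) (J-neg ji) ,
                trans (-‿cong a≈) (trans (solve 2 (λ x a → :- (x :* a) := x :* (:- a)) refl _ _) (*-congˡ (sym (element-index _)))) }
    ; *∈    = λ { r (i , ji , a≈) → index (r * element i) , J-resp (sym (element-index _)) (J-*ˡ r ji) ,
                trans (*-congˡ a≈) (trans (solve 3 (λ r x a → r :* (x :* a) := x :* (r :* a)) refl _ _ _) (*-congˡ (sym (element-index _)))) }
    }

  -- Nakayama: if x J = J for some 0 ≠ x ∈ J, then x = x s with s ∈ J, and 1 - s is a unit.
  J*J≈0 : ∀ {x y} → J x → J y → x * y ≈ 0#
  J*J≈0 {x} {y} jx jy with x ≈? 0#
  ... | yes x≈0 = trans (*-congʳ x≈0) (zeroˡ y)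
  ... | no x≉0 with classify (times-J x) (times-J-isIdeal x)
  ... | inj₁ xJ≐0        = proj₁ (xJ≐0 (x * y)) (index y , J-resp (sym (element-index y)) jy , *-congˡ (sym (element-index y)))
  ... | inj₂ (inj₂ xJ≐K) = let (i , _ , 1≈xi) = proj₂ (xJ≐K 1#) tt in ⊥-elim (J⇒¬Unit jx (element i , sym 1≈xi))
  ... | inj₂ (inj₁ xJ≐J) = ⊥-elim (x≉0 x≈0)
    where
    s : Carrier
    s = element (proj₁ (proj₂ (xJ≐J x) jx))
    js : J s
    js = proj₁ (proj₂ (proj₂ (xJ≐J x) jx))
    x≈xs : x ≈ x * s
    x≈xs = proj₂ (proj₂ (proj₂ (xJ≐J x) jx))
    1-s-unit : Unit (1# - s)
    1-s-unit = Unit-+J Unit-1# (J-neg js)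
    w : Carrier
    w = proj₁ 1-s-unit
    x≈0 : x ≈ 0#
    x≈0 = begin
      x                      ≈⟨ sym (*-identityʳ x) ⟩
      x * 1#                 ≈⟨ *-congˡ (sym (proj₂ 1-s-unit)) ⟩
      x * ((1# - s) * w)     ≈⟨ solve 3 (λ x s w → x :* ((con (+ 1) :- s) :* w) := (x :- x :* s) :* w) refl x s w ⟩
      (x - x * s) * w        ≈⟨ *-congʳ (trans (+-congʳ x≈xs) (-‿inverseʳ _)) ⟩
      0# * w                 ≈⟨ zeroˡ w ⟩
      0#                     ∎

  private
    nonzero-in-J : Σ Carrier λ x → J x × ¬ x ≈ 0#
    nonzero-in-J with ∃? (λ x → J x × ¬ x ≈ 0#) (λ x → J? x ×-dec ¬? (x ≈? 0#))
                         (λ x≈y (jx , x≉0) → J-resp x≈y jx , (λ y≈0 → x≉0 (trans x≈y y≈0)))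
    ... | yes found = found
    ... | no none   = ⊥-elim (J≉0 (λ x → J⇒≈0 x , J-≈0))
      where
      J⇒≈0 : ∀ x → J x → x ≈ 0#
      J⇒≈0 x jx with x ≈? 0#
      ... | yes x≈0 = x≈0
      ... | no x≉0  = ⊥-elim (none (x , jx , x≉0))

  t : Carrier
  t = proj₁ nonzero-in-J

  J-t : J t
  J-t = proj₁ (proj₂ nonzero-in-J)

  t≉0 : ¬ t ≈ 0#
  t≉0 = proj₂ (proj₂ nonzero-in-J)

  J-t* : ∀ r → J (t * r)
  J-t* r = J-*ʳ r J-t

  t*≈0⇒J : ∀ {y} → t * y ≈ 0# → J y
  t*≈0⇒J {y} ty≈0 with Unit? y
  ... | no ¬unit = ¬Unit⇒J ¬unit
  ... | yes (w , yw≈1) = ⊥-elim (t≉0 (begin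
    t            ≈⟨ sym (*-identityʳ t) ⟩
    t * 1#       ≈⟨ *-congˡ (sym yw≈1) ⟩
    t * (y * w)  ≈⟨ sym (*-assoc _ _ _) ⟩
    (t * y) * w  ≈⟨ *-congʳ ty≈0 ⟩
    0# * w       ≈⟨ zeroˡ w ⟩
    0#           ∎))

  J⊆tK : ∀ {x} → J x → Σ Carrier λ r → x ≈ t * r
  J⊆tK {x} jx with classify (principal t) (principal-isIdeal t)
  ... | inj₁ tK≐0        = ⊥-elim (t≉0 (proj₁ (tK≐0 t) (principal-self t)))
  ... | inj₂ (inj₂ tK≐K) = ⊥-elim (J⇒¬Unit J-t (principal-1#⇒Unit (proj₂ (tK≐K 1#) tt)))
  ... | inj₂ (inj₁ tK≐J) = let (i , x≈it) = proj₂ (tK≐J x) jx in element i , trans x≈it (*-comm _ _)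

  infix 4 _≡J_
  _≡J_ : Carrier → Carrier → Set ℓ
  x ≡J y = J (x - y)

  ≡J-isEquivalence : IsEquivalence _≡J_
  ≡J-isEquivalence = record
    { refl  = λ {x} → J-≈0 (-‿inverseʳ x)
    ; sym   = λ {x} {y} j → J-resp (solve 2 (λ x y → :- (x :- y) := y :- x) refl x y) (J-neg j)
    ; trans = λ {x} {y} {z} j₁ j₂ → J-resp (solve 3 (λ x y z → (x :- y) :+ (y :- z) := x :- z) refl x y z) (J-+ j₁ j₂)
    }

  -- The annihilator of t is J, so multiplication by t identifies K / J with J.
  t*-injective : ∀ {a b} → t * a ≈ t * b → a ≡J b
  t*-injective {a} {b} ta≈tb = t*≈0⇒J (trans (solve 3 (λ t a b → t :* (a :- b) := t :* a :- t :* b) refl t a b)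
                                             (trans (+-congʳ ta≈tb) (-‿inverseʳ _)))

  t*-cong : ∀ {a b} → a ≡J b → t * a ≈ t * b
  t*-cong {a} {b} a≡b = begin
    t * a                ≈⟨ solve 3 (λ t a b → t :* a := t :* (a :- b) :+ t :* b) refl t a b ⟩
    t * (a - b) + t * b  ≈⟨ +-congʳ (J*J≈0 J-t a≡b) ⟩
    0# + t * b           ≈⟨ +-identityˡ _ ⟩
    t * b                ∎

module ThreeIdealRingCounts {c ℓ} (K : CommutativeRing c ℓ) (N : ℕ) (K-finite : HasSize K N)
  (J : CommutativeRing.Carrier K → Set ℓ) (three : ExactlyThreeIdeals K J)
  (q : ℕ) (K/J-size : QuotientSize K J q) where

  open import Data.Fin using (Fin)
  open import Data.Nat using (_∸_) renaming (_*_ to _*ℕ_; _+_ to _+ℕ_)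
  import Data.Nat.Properties as ℕₚ
  open CommutativeRing K
  open IntegerCoefficientSolver K using (solve; _:=_; _:+_; _:-_; :-_)
  open import Relation.Binary.Reasoning.Setoid setoid
  open Counting
  open ThreeIdealRing K N K-finite J three

  class : Carrier → Fin q
  class x = Count.f K/J-size (x , tt)

  representative : Fin q → Carrier
  representative i = proj₁ (proj₁ (Count.surj K/J-size i))

  class-representative : ∀ i → class (representative i) ≡ i
  class-representative i = proj₂ (Count.surj K/J-size i)

  representative-class : ∀ x → representative (class x) ≡J x
  representative-class x = Count.inj K/J-size (_ , tt) (x , tt) (class-representative (class x))

  class-resp : ∀ {x y} → x ≡J y → class x ≡ class y
  class-resp = Count.resp K/J-size (_ , tt) (_ , tt)

  J-count : Count _≈_ J q
  J-count = count-bijection {S = _≡J_} (λ (x , jx) → cofactor jx , tt)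
    (λ (x , jx) (y , jy) x≈y → t*-injective (trans (sym (cofactor-spec jx)) (trans x≈y (cofactor-spec jy))))
    (λ (x , jx) (y , jy) x≡y → trans (cofactor-spec jx) (trans (t*-cong x≡y) (sym (cofactor-spec jy))))
    (λ (r , _) → (t * r , J-t* r) , t*-injective (sym (cofactor-spec (J-t* r))))
    K/J-size
    where
    cofactor : ∀ {x} → J x → Carrier
    cofactor jx = proj₁ (J⊆tK jx)
    cofactor-spec : ∀ {x} (jx : J x) → x ≈ t * cofactor jx
    cofactor-spec jx = proj₂ (J⊆tK jx)

  -- x ↦ (x + J, x - representative (class x)) is a bijection K ≅ K / J × J.
  K-count : Count _≈_ Univ (q *ℕ q)
  K-count = count-bijection {S = λ (x , j) (y , j′) → x ≡J y × j ≈ j′}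
    (λ (x , _) → (x , x - rep x) , tt , J-resp (solve 2 (λ a b → :- (a :- b) := b :- a) refl _ _) (J-neg (representative-class x)))
    (λ (x , _) (y , _) x≈y → ≈⇒≡J x≈y , +-cong x≈y (-‿cong (reflexive (≡.cong representative (class-resp (≈⇒≡J x≈y))))))
    (λ (x , _) (y , _) (x≡y , x-rx≈y-ry) → begin
      x                    ≈⟨ solve 2 (λ x s → x := (x :- s) :+ s) refl x _ ⟩
      (x - rep x) + rep x  ≈⟨ +-cong x-rx≈y-ry (reflexive (≡.cong representative (class-resp x≡y))) ⟩
      (y - rep y) + rep y  ≈⟨ solve 2 (λ x s → (x :- s) :+ s := x) refl y _ ⟩
      y                    ∎)
    (λ ((a , b) , _ , jb) →
      let x = rep a + b
          x≡a : x ≡J a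
          x≡a = J-resp (solve 3 (λ s a b → (s :- a) :+ b := (s :+ b) :- a) refl _ a b) (J-+ (representative-class a) jb)
      in (x , tt) , x≡a , (begin
        x - rep x          ≈⟨ +-congˡ (-‿cong (reflexive (≡.cong representative (class-resp x≡a)))) ⟩
        (rep a + b) - rep a  ≈⟨ solve 2 (λ s b → (s :+ b) :- s := b) refl _ b ⟩
        b                  ∎))
    (count-× K/J-size J-count)
    where
    rep : Carrier → Carrier
    rep x = representative (class x)
    ≈⇒≡J : ∀ {x y} → x ≈ y → x ≡J y
    ≈⇒≡J {x} {y} x≈y = J-≈0 (trans (+-congʳ x≈y) (-‿inverseʳ y))

  ≈-resp-≈0 : ∀ {x y} → x ≈ y → x ≈ 0# → y ≈ 0#
  ≈-resp-≈0 x≈y x≈0 = trans (sym x≈y) x≈0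

  private
    Unit⇔¬J : Count _≈_ (λ x → Univ x × ¬ J x) (q *ℕ q ∸ q) → Count _≈_ Unit (q *ℕ q ∸ q)
    Unit⇔¬J = count-⇔ (λ _ → refl) (λ x unit → tt , (λ jx → J⇒¬Unit jx unit)) (λ x (_ , ¬jx) → ¬J⇒Unit ¬jx)

  q*q∸q≡q*[q∸1] : q *ℕ q ∸ q ≡ q *ℕ (q ∸ 1)
  q*q∸q≡q*[q∸1] = ≡.sym (≡.trans (ℕₚ.*-distribˡ-∸ q q 1) (≡.cong (q *ℕ q ∸_) (ℕₚ.*-identityʳ q)))

  Unit-count : Count _≈_ Unit (q *ℕ (q ∸ 1))
  Unit-count = ≡.subst (Count _≈_ Unit) q*q∸q≡q*[q∸1]
    (Unit⇔¬J (count-complement isEquivalence K-count J J? (λ _ _ → J-resp)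
      (count-⇔ (λ _ → refl) (λ _ → proj₂) (λ _ jx → tt , jx) J-count)))

  ≉0-count : Count _≈_ (λ x → ¬ x ≈ 0#) (q *ℕ q ∸ 1)
  ≉0-count = count-⇔ (λ _ → refl) (λ x x≉0 → tt , x≉0) (λ x → proj₂)
    (count-complement isEquivalence K-count (λ x → x ≈ 0#) (λ x → x ≈? 0#) (λ _ _ → ≈-resp-≈0)
      (count-⇔ (λ _ → refl) (λ x (_ , x≈0) → sym x≈0) (λ x 0≈x → tt , sym 0≈x) (count-singleton isEquivalence 0#)))

  J≉0-count : Count _≈_ (λ x → J x × ¬ x ≈ 0#) (q ∸ 1)
  J≉0-count = count-complement isEquivalence J-count (λ x → x ≈ 0#) (λ x → x ≈? 0#) (λ _ _ → ≈-resp-≈0)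
    (count-⇔ (λ _ → refl) (λ x (_ , x≈0) → sym x≈0) (λ x 0≈x → J-≈0 (sym 0≈x) , sym 0≈x) (count-singleton isEquivalence 0#))

  Unit/J-count : Count _≡J_ Unit (q ∸ 1)
  Unit/J-count = count-⇔ (λ _ → IsEquivalence.refl ≡J-isEquivalence) (λ x unit → tt , (λ jx → J⇒¬Unit jx unit)) (λ x (_ , ¬jx) → ¬J⇒Unit ¬jx)
    (count-complement ≡J-isEquivalence K/J-size J J? (λ x y x≡y jx → J-resp (solve 2 (λ x y → x :- (x :- y) := y) refl x y) (J-sub jx x≡y))
      (record { f = λ _ → Fin.zero ; resp = λ _ _ _ → ≡.refl
              ; inj = λ (x , _ , jx) (y , _ , jy) _ → J-sub jx jy
              ; surj = λ { Fin.zero → (0# , tt , J-0#) , ≡.refl } }))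
    where import Data.Fin as Fin

  2≤q : 2 ℕ.≤ q
  2≤q = ℕₚ.≤-trans (ℕ.s≤s (count-nonempty J≉0-count t (J-t , t≉0)))
                   (ℕₚ.≤-reflexive (ℕₚ.m+[n∸m]≡n (count-nonempty J-count 0# J-0#)))

module UnimodularVectors {c ℓ} (K : CommutativeRing c ℓ) (N : ℕ) (K-finite : HasSize K N)
  (J : CommutativeRing.Carrier K → Set ℓ) (three : ExactlyThreeIdeals K J) (e : ℕ) where

  open import Data.Fin as Fin using (Fin; _↑ˡ_; _↑ʳ_; splitAt)
  import Data.Fin.Properties as Fin
  open CommutativeRing K
  open IntegerCoefficientSolver K using (solve; _:=_; _:+_; _:*_; _:-_; :-_; con)
  open import Relation.Binary.Reasoning.Setoid setoid
  open import Data.Integer using (+_)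
  open ThreeIdealRing K N K-finite J three
  open SymplecticForm K e

  J-Sum : ∀ {n} (f : Fin n → Carrier) → (∀ i → J (f i)) → J (Sum K f)
  J-Sum {zero}  f J-f = J-0#
  J-Sum {suc n} f J-f = J-+ (J-f Fin.zero) (J-Sum _ (λ i → J-f (Fin.suc i)))

  J-vector : K²ᵉ → Set ℓ
  J-vector z = ∀ k → J (z k)

  J-vector? : ∀ z → Dec (J-vector z)
  J-vector? z = Fin.all? (λ k → J? (z k))

  J-vector-resp : ∀ {z z′} → z ≋ z′ → J-vector z → J-vector z′
  J-vector-resp z≋z′ Jz k = J-resp (z≋z′ k) (Jz k)

  Unimodular-* : ∀ {u a} → Unit u → Unimodular K e a → Unimodular K e (λ i → u * a i)
  Unimodular-* u-unit (k , unit) = k , Unit-* u-unit unit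

  Unimodular⇒¬J-vector : ∀ {z} → Unimodular K e z → ¬ J-vector z
  Unimodular⇒¬J-vector (k , unit) Jz = J⇒¬Unit (Jz k) unit

  ¬J-vector⇒Unimodular : ∀ {z} → ¬ J-vector z → Unimodular K e z
  ¬J-vector⇒Unimodular {z} ¬Jz with Fin.any? (λ k → Unit? (z k))
  ... | yes found = found
  ... | no none   = ⊥-elim (¬Jz (λ k → ¬Unit⇒J (λ unit → none (k , unit))))

  Unimodular-cancel : ∀ {b u u′} → Unimodular K e b → (∀ i → u * b i ≈ u′ * b i) → u ≈ u′
  Unimodular-cancel {b} {u} {u′} (k , (β , bβ≈1)) ub≈u′b = begin
    u              ≈⟨ sym (*-identityʳ u) ⟩
    u * 1#         ≈⟨ *-congˡ (sym bβ≈1) ⟩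
    u * (b k * β)  ≈⟨ sym (*-assoc _ _ _) ⟩
    (u * b k) * β  ≈⟨ *-congʳ (ub≈u′b k) ⟩
    (u′ * b k) * β ≈⟨ *-assoc _ _ _ ⟩
    u′ * (b k * β) ≈⟨ *-congˡ bβ≈1 ⟩
    u′ * 1#        ≈⟨ *-identityʳ u′ ⟩
    u′             ∎

  Unimodular-cancel-J : ∀ {a x} → Unimodular K e a → (∀ k → J (x * a k)) → J x
  Unimodular-cancel-J {a} {x} (i , (α , aα≈1)) J-xa =
    J-resp (trans (*-assoc _ _ _) (trans (*-congˡ aα≈1) (*-identityʳ x))) (J-*ʳ α (J-xa i))

  ⟪⟫-J : ∀ a {z} → J-vector z → J ⟪ a , z ⟫
  ⟪⟫-J a {z} Jz = J-resp (sym (⟪⟫≈dot a z)) (J-Sum _ (λ k → J-*ˡ ((a ᴹ) k) (Jz k)))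

  ⟪⟫-ε : ∀ a i → ⟪ a , ε i ⟫ ≈ (a ᴹ) i
  ⟪⟫-ε a i = trans (⟪⟫≈dot a (ε i)) (dot-ε (a ᴹ) i)

  private
    ↑-view : ∀ (k : Fin (e ℕ.+ e)) → (Σ (Fin e) λ i → k ≡ i ↑ˡ e) ⊎ (Σ (Fin e) λ i → k ≡ e ↑ʳ i)
    ↑-view k with splitAt e k | Fin.join-splitAt e e k
    ... | inj₁ i | eq = inj₁ (i , ≡.sym eq)
    ... | inj₂ i | eq = inj₂ (i , ≡.sym eq)

  ᴹ-J-vector : ∀ v → J-vector (v ᴹ) → J-vector v
  ᴹ-J-vector v J-vᴹ k with ↑-view k
  ... | inj₁ (i , ≡.refl) = ≡.subst J (ᴹ-↑ʳ v i) (J-vᴹ (e ↑ʳ i))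
  ... | inj₂ (i , ≡.refl) = J-resp (solve 1 (λ x → :- (:- x) := x) refl _) (J-neg (≡.subst J (ᴹ-↑ˡ v i) (J-vᴹ (i ↑ˡ e))))

  ᴹ-Unimodular : ∀ v → Unimodular K e v → Unimodular K e (v ᴹ)
  ᴹ-Unimodular v (k , unit) with ↑-view k
  ... | inj₁ (i , ≡.refl) = (e ↑ʳ i) , ≡.subst Unit (≡.sym (ᴹ-↑ʳ v i)) unit
  ... | inj₂ (i , ≡.refl) = (i ↑ˡ e) , ≡.subst Unit (≡.sym (ᴹ-↑ˡ v i)) (Unit-neg unit)

  Proportional-mod-J : K²ᵉ → K²ᵉ → Set (c ⊔ ℓ)
  Proportional-mod-J a w = Σ Carrier λ r → ∀ k → w k ≡J r * a k

  record Independent (a w : K²ᵉ) : Set (c ⊔ ℓ) where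
    field
      z₀ z₁ : K²ᵉ
      a·z₀≈1 : ⟪ a , z₀ ⟫ ≈ 1#
      w·z₀≈0 : ⟪ w , z₀ ⟫ ≈ 0#
      a·z₁≈0 : ⟪ a , z₁ ⟫ ≈ 0#
      w·z₁≈1 : ⟪ w , z₁ ⟫ ≈ 1#

  minor : K²ᵉ → K²ᵉ → Fin (e ℕ.+ e) → Fin (e ℕ.+ e) → Carrier
  minor a w i k = (a ᴹ) i * (w ᴹ) k - (a ᴹ) k * (w ᴹ) i

  -- Either some 2×2 minor of (a M, w M) is a unit, and Cramer's rule gives z₀ and z₁,
  -- or all minors lie in J, and then w M ≡ r (a M) mod J.
  proportional-or-independent : ∀ a w → Unimodular K e a → Proportional-mod-J a w ⊎ Independent a w
  proportional-or-independent a w a-unimod with Fin.any? (λ i → Fin.any? (λ k → Unit? (minor a w i k)))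
  ... | yes (i , k , d , Dd≈1) = inj₂ (record
    { z₀ = λ m → (d * W k) * ε i m + (- (d * W i)) * ε k m
    ; z₁ = λ m → (d * A i) * ε k m + (- (d * A k)) * ε i m
    ; a·z₀≈1 = trans (pair a (d * W k) (- (d * W i)) i k)
        (trans (solve 5 (λ d wk ai wi ak → d :* wk :* ai :+ (:- (d :* wi)) :* ak := (ai :* wk :- ak :* wi) :* d) refl d (W k) (A i) (W i) (A k)) Dd≈1)
    ; w·z₀≈0 = trans (pair w (d * W k) (- (d * W i)) i k)
        (solve 3 (λ d wk wi → d :* wk :* wi :+ (:- (d :* wi)) :* wk := con (+ 0)) refl d (W k) (W i))
    ; a·z₁≈0 = trans (pair a (d * A i) (- (d * A k)) k i)
        (solve 3 (λ d ai ak → d :* ai :* ak :+ (:- (d :* ak)) :* ai := con (+ 0)) refl d (A i) (A k))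
    ; w·z₁≈1 = trans (pair w (d * A i) (- (d * A k)) k i)
        (trans (solve 5 (λ d ai wk ak wi → d :* ai :* wk :+ (:- (d :* ak)) :* wi := (ai :* wk :- ak :* wi) :* d) refl d (A i) (W k) (A k) (W i)) Dd≈1)
    })
    where
    A W : K²ᵉ
    A = a ᴹ
    W = w ᴹ
    pair : ∀ b x y i k → ⟪ b , (λ m → x * ε i m + y * ε k m) ⟫ ≈ x * (b ᴹ) i + y * (b ᴹ) k
    pair b x y i k = trans (⟪⟫-linearʳ b x (ε i) y (ε k)) (+-cong (*-congˡ (⟪⟫-ε b i)) (*-congˡ (⟪⟫-ε b k)))
  ... | no no-unit-minor = inj₁ (r , λ k →
    J-resp (solve 3 (λ w r a → w :+ (:- r) :* a := w :- r :* a) refl (w k) r (a k)) (ᴹ-J-vector _ J-[w-ra]ᴹ k))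
    where
    A W : K²ᵉ
    A = a ᴹ
    W = w ᴹ
    i₀ : Fin (e ℕ.+ e)
    i₀ = proj₁ (ᴹ-Unimodular a a-unimod)
    α : Carrier
    α = proj₁ (proj₂ (ᴹ-Unimodular a a-unimod))
    Aα≈1 : A i₀ * α ≈ 1#
    Aα≈1 = proj₂ (proj₂ (ᴹ-Unimodular a a-unimod))
    r : Carrier
    r = W i₀ * α
    J-[w-ra]ᴹ : J-vector ((λ k → w k + (- r) * a k) ᴹ)
    J-[w-ra]ᴹ k = J-resp (trans minor≈ (sym (ᴹ-+* w (- r) a k))) (J-*ˡ α (¬Unit⇒J (λ unit → no-unit-minor (i₀ , k , unit))))
      where
      minor≈ : α * (A i₀ * W k - A k * W i₀) ≈ W k + (- r) * A k
      minor≈ = begin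
        α * (A i₀ * W k - A k * W i₀)
          ≈⟨ solve 5 (λ α a₀ wk ak w₀ → α :* (a₀ :* wk :- ak :* w₀) := (a₀ :* α) :* wk :+ (:- (w₀ :* α)) :* ak) refl α (A i₀) (W k) (A k) (W i₀) ⟩
        (A i₀ * α) * W k + (- r) * A k
          ≈⟨ +-congʳ (trans (*-congʳ Aα≈1) (*-identityˡ _)) ⟩
        W k + (- r) * A k ∎

module UnimodularVectorCounts {c ℓ} (K : CommutativeRing c ℓ) (N : ℕ) (K-finite : HasSize K N)
  (J : CommutativeRing.Carrier K → Set ℓ) (three : ExactlyThreeIdeals K J)
  (q : ℕ) (K/J-size : QuotientSize K J q) (e : ℕ) where

  open import Relation.Nullary.Decidable using (_×-dec_)
  open import Data.Nat using () renaming (_*_ to _*ℕ_; _+_ to _+ℕ_; _^_ to _^ℕ_)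
  open CommutativeRing K
  open IntegerCoefficientSolver K using (solve; _:=_; _:+_; _:*_; :-_)
  open import Relation.Binary.Reasoning.Setoid setoid
  open Counting
  open ThreeIdealRing K N K-finite J three
  open ThreeIdealRingCounts K N K-finite J three q K/J-size
  open SymplecticForm K e
  open UnimodularVectors K N K-finite J three e

  _≈²_ : Carrier × Carrier → Carrier × Carrier → Set ℓ
  (x , y) ≈² (x′ , y′) = (x ≈ x′) × (y ≈ y′)

  K²ᵉ-count : Count _≋_ Univ ((q *ℕ q) ^ℕ (e +ℕ e))
  K²ᵉ-count = count-⇔ (λ z i → refl) (λ _ _ _ → tt) (λ _ _ → tt) (count-Fin→ (λ _ → refl) K-count (e +ℕ e))

  J-vector-count : Count _≋_ J-vector (q ^ℕ (e +ℕ e))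
  J-vector-count = count-Fin→ (λ _ → refl) J-count (e +ℕ e)

  Unimodular-count : Σ ℕ λ M → Count _≋_ (Unimodular K e) M × q ^ℕ (e +ℕ e) +ℕ M ≡ (q *ℕ q) ^ℕ (e +ℕ e)
  Unimodular-count =
    let (M , c , eq) = count-partition ≋-isEquivalence K²ᵉ-count J-vector J-vector? (λ _ _ → J-vector-resp)
                         (count-⇔ (λ _ _ → refl) (λ _ → proj₂) (λ _ Jz → tt , Jz) J-vector-count)
    in M , count-⇔ (λ _ _ → refl) (λ _ unimod → tt , Unimodular⇒¬J-vector unimod) (λ _ (_ , ¬Jz) → ¬J-vector⇒Unimodular ¬Jz) c , eq

  ≈²-refl : ∀ x → x ≈² x
  ≈²-refl _ = refl , refl

  module Coordinates {a w : K²ᵉ} (independent : Independent a w) where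
    open Independent independent

    Perp : K²ᵉ → Set ℓ
    Perp z = (⟪ a , z ⟫ ≈ 0#) × (⟪ w , z ⟫ ≈ 0#)

    Perp? : ∀ z → Dec (Perp z)
    Perp? z = (⟪ a , z ⟫ ≈? 0#) ×-dec (⟪ w , z ⟫ ≈? 0#)

    Perp-resp : ∀ z z′ → z ≋ z′ → Perp z → Perp z′
    Perp-resp z z′ z≋z′ (az≈0 , wz≈0) = trans (sym (⟪⟫-congʳ a z≋z′)) az≈0 , trans (sym (⟪⟫-congʳ w z≋z′)) wz≈0

    combine : K²ᵉ → Carrier → Carrier → K²ᵉ
    combine k x y m = k m + (x * z₀ m + y * z₁ m)

    ⟪a,combine⟫ : ∀ k x y → ⟪ a , combine k x y ⟫ ≈ ⟪ a , k ⟫ + x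
    ⟪a,combine⟫ k x y = trans (⟪⟫-+ʳ a k (λ m → x * z₀ m + y * z₁ m)) (+-congˡ (trans (⟪⟫-linearʳ a x z₀ y z₁)
      (trans (+-cong (trans (*-congˡ a·z₀≈1) (*-identityʳ x)) (trans (*-congˡ a·z₁≈0) (zeroʳ y))) (+-identityʳ x))))

    ⟪w,combine⟫ : ∀ k x y → ⟪ w , combine k x y ⟫ ≈ ⟪ w , k ⟫ + y
    ⟪w,combine⟫ k x y = trans (⟪⟫-+ʳ w k (λ m → x * z₀ m + y * z₁ m)) (+-congˡ (trans (⟪⟫-linearʳ w x z₀ y z₁)
      (trans (+-cong (trans (*-congˡ w·z₀≈0) (zeroʳ x)) (trans (*-congˡ w·z₁≈1) (*-identityʳ y))) (+-identityˡ y))))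

    project : K²ᵉ → K²ᵉ
    project z = combine z (- ⟪ a , z ⟫) (- ⟪ w , z ⟫)

    Perp-project : ∀ z → Perp (project z)
    Perp-project z = trans (⟪a,combine⟫ z _ _) (-‿inverseʳ _) , trans (⟪w,combine⟫ z _ _) (-‿inverseʳ _)

    project-cong : ∀ {z z′} → z ≋ z′ → project z ≋ project z′
    project-cong z≋z′ m = +-cong (z≋z′ m) (+-cong (*-congʳ (-‿cong (⟪⟫-congʳ a z≋z′))) (*-congʳ (-‿cong (⟪⟫-congʳ w z≋z′))))

    combine-project : ∀ z → combine (project z) ⟪ a , z ⟫ ⟪ w , z ⟫ ≋ z
    combine-project z m = solve 5 (λ zm x u y v → (zm :+ ((:- x) :* u :+ (:- y) :* v)) :+ (x :* u :+ y :* v) := zm)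
                                refl (z m) ⟪ a , z ⟫ (z₀ m) ⟪ w , z ⟫ (z₁ m)

    ⟪a,combine-Perp⟫ : ∀ k x y → Perp k → ⟪ a , combine k x y ⟫ ≈ x
    ⟪a,combine-Perp⟫ k x y (ak≈0 , _) = trans (⟪a,combine⟫ k x y) (trans (+-congʳ ak≈0) (+-identityˡ x))

    ⟪w,combine-Perp⟫ : ∀ k x y → Perp k → ⟪ w , combine k x y ⟫ ≈ y
    ⟪w,combine-Perp⟫ k x y (_ , wk≈0) = trans (⟪w,combine⟫ k x y) (trans (+-congʳ wk≈0) (+-identityˡ y))

    project-combine : ∀ k x y → Perp k → project (combine k x y) ≋ k
    project-combine k x y k⊥ m = begin
      combine k x y m + ((- ⟪ a , combine k x y ⟫) * z₀ m + (- ⟪ w , combine k x y ⟫) * z₁ m)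
        ≈⟨ +-congˡ (+-cong (*-congʳ (-‿cong (⟪a,combine-Perp⟫ k x y k⊥))) (*-congʳ (-‿cong (⟪w,combine-Perp⟫ k x y k⊥)))) ⟩
      (k m + (x * z₀ m + y * z₁ m)) + ((- x) * z₀ m + (- y) * z₁ m)
        ≈⟨ solve 5 (λ km x u y v → (km :+ (x :* u :+ y :* v)) :+ ((:- x) :* u :+ (:- y) :* v) := km) refl (k m) x (z₀ m) y (z₁ m) ⟩
      k m ∎

    count-by-coordinates : ∀ {v p π} (V : K²ᵉ → Set v) (P : Carrier → Set p) (Π : Carrier → Carrier → Set π) →
      (∀ {x x′ y y′} → x ≈ x′ → y ≈ y′ → Π x y → Π x′ y′) →
      (∀ z → V z → P ⟪ a , z ⟫) → (∀ z → V z → P ⟪ w , z ⟫) →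
      (∀ z → V z → V (project z)) → (∀ k x y → V k → P x → P y → V (combine k x y)) →
      ∀ {n-Π n-⊥} → Count _≈²_ (λ (x , y) → (P x × P y) × Π x y) n-Π →
      Count _≋_ (λ z → V z × Perp z) n-⊥ →
      Count _≋_ (λ z → V z × Π ⟪ a , z ⟫ ⟪ w , z ⟫) (n-Π *ℕ n-⊥)
    count-by-coordinates V P Π Π-resp P-a P-w V-project V-combine c-Π c-⊥ =
      count-bijection {S = λ (xy , k) (xy′ , k′) → xy ≈² xy′ × k ≋ k′} coordinates
        (λ (z , _) (z′ , _) z≋z′ → (⟪⟫-congʳ a z≋z′ , ⟪⟫-congʳ w z≋z′) , project-cong z≋z′)
        (λ (z , _) (z′ , _) ((a≈ , w≈) , p≋) m → trans (sym (combine-project z m))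
               (trans (+-cong (p≋ m) (+-cong (*-congʳ a≈) (*-congʳ w≈))) (combine-project z′ m)))
        (λ (((x , y) , k) , ((px , py) , πxy) , (vk , k⊥)) →
             let ax≈ = ⟪a,combine-Perp⟫ k x y k⊥ ; wy≈ = ⟪w,combine-Perp⟫ k x y k⊥ in
             (combine k x y , V-combine k x y vk px py , Π-resp (sym ax≈) (sym wy≈) πxy) , (ax≈ , wy≈) , project-combine k x y k⊥)
        (count-× c-Π c-⊥)
      where
      coordinates : Σ K²ᵉ (λ z → V z × Π ⟪ a , z ⟫ ⟪ w , z ⟫) →
        Σ ((Carrier × Carrier) × K²ᵉ) (λ ((x , y) , k) → ((P x × P y) × Π x y) × (V k × Perp k))
      coordinates (z , vz , πz) = ((⟪ a , z ⟫ , ⟪ w , z ⟫) , project z) , ((P-a z vz , P-w z vz) , πz) , (V-project z vz , Perp-project z)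

    private
      Perp-count : Σ ℕ λ n → Count _≋_ (λ z → Univ z × Perp z) n
      Perp-count = count-subset ≋-isEquivalence K²ᵉ-count Perp Perp? Perp-resp

      J-Perp-count : Σ ℕ λ n → Count _≋_ (λ z → J-vector z × Perp z) n
      J-Perp-count = count-subset ≋-isEquivalence J-vector-count Perp Perp? Perp-resp

    c₀ d₀ : ℕ
    c₀ = proj₁ Perp-count
    d₀ = proj₁ J-Perp-count

    count-all-by : ∀ {π} (Π : Carrier → Carrier → Set π) → (∀ {x x′ y y′} → x ≈ x′ → y ≈ y′ → Π x y → Π x′ y′) →
      ∀ {n-Π} → Count _≈²_ (λ (x , y) → (Univ x × Univ y) × Π x y) n-Π →
      Count _≋_ (λ z → Univ z × Π ⟪ a , z ⟫ ⟪ w , z ⟫) (n-Π *ℕ c₀)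
    count-all-by Π Π-resp c-Π = count-by-coordinates Univ Univ Π Π-resp
      (λ _ _ → tt) (λ _ _ → tt) (λ _ _ → tt) (λ _ _ _ _ _ _ → tt) c-Π (proj₂ Perp-count)

    count-J-vectors-by : ∀ {π} (Π : Carrier → Carrier → Set π) → (∀ {x x′ y y′} → x ≈ x′ → y ≈ y′ → Π x y → Π x′ y′) →
      ∀ {n-Π} → Count _≈²_ (λ (x , y) → (J x × J y) × Π x y) n-Π →
      Count _≋_ (λ z → J-vector z × Π ⟪ a , z ⟫ ⟪ w , z ⟫) (n-Π *ℕ d₀)
    count-J-vectors-by Π Π-resp c-Π = count-by-coordinates J-vector J Π Π-resp (λ z → ⟪⟫-J a) (λ z → ⟪⟫-J w)
      (λ z Jz m → J-+ (Jz m) (J-+ (J-*ʳ _ (J-neg (⟪⟫-J a Jz))) (J-*ʳ _ (J-neg (⟪⟫-J w Jz)))))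
      (λ k x y Jk jx jy m → J-+ (Jk m) (J-+ (J-*ʳ _ jx) (J-*ʳ _ jy)))
      c-Π (proj₂ J-Perp-count)

    c₀-spec : ((q *ℕ q) *ℕ (q *ℕ q)) *ℕ c₀ ≡ (q *ℕ q) ^ℕ (e +ℕ e)
    c₀-spec = count-unique
      (count-⇔ (λ _ _ → refl) (λ _ _ → tt , tt) (λ _ _ → tt)
        (count-all-by (λ _ _ → ⊤ {ℓ = lzero}) (λ _ _ _ → tt)
          (count-⇔ ≈²-refl (λ _ _ → tt , tt) (λ _ _ → (tt , tt) , tt) (count-× K-count K-count))))
      K²ᵉ-count

    d₀-spec : (q *ℕ q) *ℕ d₀ ≡ q ^ℕ (e +ℕ e)
    d₀-spec = count-unique
      (count-⇔ (λ _ _ → refl) (λ z Jz → Jz , tt) (λ z → proj₁)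
        (count-J-vectors-by (λ _ _ → ⊤ {ℓ = lzero}) (λ _ _ _ → tt)
          (count-⇔ ≈²-refl (λ _ → proj₁) (λ _ jj → jj , tt) (count-× J-count J-count))))
      J-vector-count

    count-unimodular-by : ∀ {π} (Π : Carrier → Carrier → Set π) → (∀ {x x′ y y′} → x ≈ x′ → y ≈ y′ → Π x y → Π x′ y′) →
      ∀ {n-Π n-JΠ} → Count _≈²_ (λ (x , y) → (Univ x × Univ y) × Π x y) n-Π →
      Count _≈²_ (λ (x , y) → (J x × J y) × Π x y) n-JΠ →
      Σ ℕ λ n → Count _≋_ (λ z → Unimodular K e z × Π ⟪ a , z ⟫ ⟪ w , z ⟫) n × n-JΠ *ℕ d₀ +ℕ n ≡ n-Π *ℕ c₀
    count-unimodular-by Π Π-resp c-Π c-JΠ =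
      let (n , c , eq) = count-partition ≋-isEquivalence (count-all-by Π Π-resp c-Π) J-vector J-vector? (λ _ _ → J-vector-resp)
                           (count-⇔ (λ _ _ → refl) (λ z ((_ , π) , Jz) → Jz , π) (λ z (Jz , π) → (tt , π) , Jz)
                             (count-J-vectors-by Π Π-resp c-JΠ))
      in n , count-⇔ (λ _ _ → refl) (λ z (unimod , π) → (tt , π) , Unimodular⇒¬J-vector unimod)
                                     (λ z ((_ , π) , ¬Jz) → ¬J-vector⇒Unimodular ¬Jz , π) c , eq

module Points {c ℓ} (K : CommutativeRing c ℓ) (N : ℕ) (K-finite : HasSize K N)
  (J : CommutativeRing.Carrier K → Set ℓ) (three : ExactlyThreeIdeals K J)
  (q : ℕ) (K/J-size : QuotientSize K J q) (e : ℕ) where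

  open import Data.Fin as Fin using (Fin)
  import Data.Fin.Properties as Fin
  open import Relation.Nullary.Decidable using (_×-dec_)
  open import Data.Nat using (_∸_) renaming (_*_ to _*ℕ_; _+_ to _+ℕ_; _^_ to _^ℕ_)
  open CommutativeRing K
  open IntegerCoefficientSolver K using (solve; _:=_; _:+_; _:*_; _:-_; :-_)
  open import Relation.Binary.Reasoning.Setoid setoid
  open import Algebra.Properties.Ring ring using (-0#≈0#)
  open Counting
  open ThreeIdealRing K N K-finite J three
  open ThreeIdealRingCounts K N K-finite J three q K/J-size
  open SymplecticForm K e
  open UnimodularVectors K N K-finite J three e
  open UnimodularVectorCounts K N K-finite J three q K/J-size e

  Point : Set (c ⊔ ℓ)
  Point = V' K e

  _∼_ : Point → Point → Set (c ⊔ ℓ)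
  _∼_ = _∼V_ K {e}

  _≋ₚ_ : Point → Point → Set ℓ
  x ≋ₚ y = proj₁ x ≋ proj₁ y

  ≋ₚ-isEquivalence : IsEquivalence _≋ₚ_
  ≋ₚ-isEquivalence = record { refl = λ i → refl ; sym = λ h i → sym (h i) ; trans = λ h g i → trans (h i) (g i) }

  ∼-isEquivalence : IsEquivalence _∼_
  ∼-isEquivalence = record
    { refl  = 1# , Unit-1# , (λ i → sym (*-identityˡ _))
    ; sym   = λ (u , u-unit , a≈ub) → let (w , w-unit , wu≈1) = Unit-inverse u-unit in
        w , w-unit , (λ i → sym (trans (*-congˡ (a≈ub i)) (trans (sym (*-assoc _ _ _)) (trans (*-congʳ wu≈1) (*-identityˡ _)))))
    ; trans = λ (u , u-unit , a≈ub) (v , v-unit , b≈vc) →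
        u * v , Unit-* u-unit v-unit , (λ i → trans (a≈ub i) (trans (*-congˡ (b≈vc i)) (sym (*-assoc _ _ _))))
    }

  ≋ₚ⇒∼ : ∀ {x y} → x ≋ₚ y → x ∼ y
  ≋ₚ⇒∼ x≋y = 1# , Unit-1# , (λ i → trans (x≋y i) (sym (*-identityˡ _)))

  _∼?_ : ∀ x y → Dec (x ∼ y)
  (a , _) ∼? (b , _) = ∃? (λ u → Unit u × (∀ i → a i ≈ u * b i))
    (λ u → Unit? u ×-dec Fin.all? (λ i → a i ≈? (u * b i)))
    (λ u≈u′ (u-unit , a≈ub) → Unit-resp u≈u′ u-unit , (λ i → trans (a≈ub i) (*-congʳ u≈u′)))

  fibre-count : ∀ {p n} (P : Point → Set p) → (∀ x y → x ∼ y → P x → P y) → Count _≈_ Unit n →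
    ∀ x → P x → Count _≋ₚ_ (λ y → P y × x ∼ y) n
  fibre-count P P-resp c-Unit (a , a-unimod) px = count-bijection {S = _≈_} {Q = Unit}
    (λ (y , _ , (u , u-unit , _)) → u , u-unit)
    (λ ((b , b-unimod) , _ , (u , _ , a≈ub)) (_ , _ , (u′ , _ , a≈u′b′)) b≋b′ →
       Unimodular-cancel b-unimod (λ i → trans (sym (a≈ub i)) (trans (a≈u′b′ i) (*-congˡ (sym (b≋b′ i))))))
    (λ (_ , _ , (u , u-unit , a≈ub)) (_ , _ , (u′ , _ , a≈u′b′)) u≈u′ i →
       Unit-cancelˡ u-unit (trans (sym (a≈ub i)) (trans (a≈u′b′ i) (*-congʳ (sym u≈u′)))))
    (λ (u , u-unit) → let (w , w-unit , wu≈1) = Unit-inverse u-unit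
                          y = (λ i → w * a i) , Unimodular-* w-unit a-unimod
                          x∼y = u , u-unit , (λ i → sym (trans (sym (*-assoc _ _ _)) (trans (*-congʳ (trans (*-comm u w) wu≈1)) (*-identityˡ _))))
                      in (y , P-resp _ _ x∼y px , x∼y) , refl)
    c-Unit

  count-points : ∀ {p} (P : Point → Set p) → (∀ x y → x ∼ y → P x → P y) → ∀ {M} → Count _≋ₚ_ P M →
    Σ ℕ λ m → Count _∼_ P m × m *ℕ (q *ℕ (q ∸ 1)) ≡ M
  count-points P P-resp {M} c = divide Unit-count (count-nonempty Unit-count 1# Unit-1#)
    where
    divide : ∀ {n} → Count _≈_ Unit n → 1 ℕ.≤ n → Σ ℕ λ m → Count _∼_ P m × m *ℕ n ≡ M
    divide {suc s} c-Unit _ = count-quotient ≋ₚ-isEquivalence ∼-isEquivalence (λ {x} {y} → ≋ₚ⇒∼ {x} {y}) _∼?_ s c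
      (λ x px → fibre-count P P-resp c-Unit x px)

  vectors→points : ∀ {p} (Q : K²ᵉ → Set p) → ∀ {M} → Count _≋_ (λ z → Unimodular K e z × Q z) M →
    Count _≋ₚ_ (λ y → Q (proj₁ y)) M
  vectors→points Q = count-bijection (λ ((z , unimod) , qz) → z , unimod , qz) (λ _ _ z≋ → z≋) (λ _ _ z≋ → z≋)
    (λ (z , unimod , qz) → ((z , unimod) , qz) , (λ i → refl))

  Point-count : Σ ℕ λ v → Count _∼_ Univ v × v *ℕ (q *ℕ (q ∸ 1)) ≡ proj₁ Unimodular-count
  Point-count = count-points Univ (λ _ _ _ _ → tt)
    (vectors→points Univ (count-⇔ (λ _ _ → refl) (λ _ → proj₁) (λ _ unimod → unimod , tt) (proj₁ (proj₂ Unimodular-count))))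

  Adjacent : Point → Point → Set ℓ
  Adjacent = AdjX K {e}

  Adjacent-sym : ∀ x y → Adjacent x y → Adjacent y x
  Adjacent-sym (a , _) (b , _) ab≉0 ba≈0 =
    ab≉0 (trans (⟪⟫-antisym a b) (trans (-‿cong ba≈0) -0#≈0#))

  Adjacent-irrefl : ∀ x → ¬ Adjacent x x
  Adjacent-irrefl (a , _) aa≉0 = aa≉0 (⟪⟫-alternating a)

  Adjacent-resp : ∀ x y y′ → y ∼ y′ → Adjacent x y → Adjacent x y′
  Adjacent-resp (a , _) (b , _) (b′ , _) (u , _ , b≈ub′) ab≉0 ab′≈0 =
    ab≉0 (trans (⟪⟫-congʳ a b≈ub′) (trans (⟪⟫-*ʳ a u b′) (trans (*-congˡ ab′≈0) (zeroʳ u))))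

  SameClass : Point → Point → Set (c ⊔ ℓ)
  SameClass (a , _) (b , _) = Σ Carrier λ u → Unit u × (∀ k → b k ≡J u * a k)

  SameClass-isEquivalence : IsEquivalence SameClass
  SameClass-isEquivalence = record
    { refl  = λ {(a , _)} → 1# , Unit-1# , (λ k → J-≈0 (trans (+-congˡ (-‿cong (*-identityˡ _))) (-‿inverseʳ _)))
    ; sym   = λ {(a , _)} {(b , _)} (u , u-unit , b≡ua) → let (w , w-unit , wu≈1) = Unit-inverse u-unit in
        w , w-unit , (λ k → J-resp (flip a b u w wu≈1 k) (J-*ˡ (- w) (b≡ua k)))
    ; trans = λ {(a , _)} {(b , _)} {(c , _)} (u , u-unit , b≡ua) (v , v-unit , c≡vb) →
        v * u , Unit-* v-unit u-unit ,
        (λ k → J-resp (solve 5 (λ ck v bk u ak → (ck :- v :* bk) :+ v :* (bk :- u :* ak) := ck :- (v :* u) :* ak) refl (c k) v (b k) u (a k))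
                      (J-+ (c≡vb k) (J-*ˡ v (b≡ua k))))
    }
    where
    flip : ∀ (a b : K²ᵉ) u w → w * u ≈ 1# → ∀ k → (- w) * (b k - u * a k) ≈ a k - w * b k
    flip a b u w wu≈1 k = begin
      (- w) * (b k - u * a k)  ≈⟨ solve 4 (λ w bk u ak → (:- w) :* (bk :- u :* ak) := (w :* u) :* ak :- w :* bk) refl w (b k) u (a k) ⟩
      (w * u) * a k - w * b k  ≈⟨ +-congʳ (trans (*-congʳ wu≈1) (*-identityˡ _)) ⟩
      a k - w * b k            ∎

  ∼⇒SameClass : ∀ {x y} → x ∼ y → SameClass x y
  ∼⇒SameClass {a , _} {b , _} (u , u-unit , a≈ub) = let (w , w-unit , wu≈1) = Unit-inverse u-unit in
    w , w-unit , (λ k → J-≈0 (begin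
      b k - w * a k        ≈⟨ +-congˡ (-‿cong (*-congˡ (a≈ub k))) ⟩
      b k - w * (u * b k)  ≈⟨ +-congˡ (-‿cong (trans (sym (*-assoc _ _ _)) (trans (*-congʳ wu≈1) (*-identityˡ _)))) ⟩
      b k - b k            ≈⟨ -‿inverseʳ _ ⟩
      0#                   ∎))

  SameClass? : ∀ x y → Dec (SameClass x y)
  SameClass? (a , _) (b , _) = ∃? (λ u → Unit u × (∀ k → b k ≡J u * a k))
    (λ u → Unit? u ×-dec Fin.all? (λ k → J? (b k - u * a k)))
    (λ u≈u′ (u-unit , b≡ua) → Unit-resp u≈u′ u-unit , (λ k → J-resp (+-congˡ (-‿cong (*-congʳ u≈u′))) (b≡ua k)))

  -- b ↦ (u mod J, b - ũ a), with ũ the chosen representative of u + J, identifies the vectors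
  -- of the class of a with (K / J)^× × J²ᵉ.
  class-vector-count : ∀ x → Count _≋ₚ_ (SameClass x) ((q ∸ 1) *ℕ q ^ℕ (e +ℕ e))
  class-vector-count (a , a-unimod) = count-bijection {S = λ (u , j) (u′ , j′) → u ≡J u′ × j ≋ j′}
    {Q = λ (u , j) → Unit u × J-vector j}
    (λ ((b , _) , (u , u-unit , b≡ua)) → (u , (λ k → b k - rep u * a k)) , u-unit ,
       (λ k → J-resp (solve 4 (λ bk u ak s → (bk :- u :* ak) :+ (:- (s :- u)) :* ak := bk :- s :* ak) refl (b k) u (a k) _)
                     (J-+ (b≡ua k) (J-*ʳ (a k) (J-neg (representative-class u))))))
    (λ ((b , _) , (u , _ , b≡ua)) ((b′ , _) , (u′ , _ , b′≡u′a)) b≋b′ →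
       let u≡u′ : u ≡J u′
           u≡u′ = Unimodular-cancel-J a-unimod (λ k →
             J-resp (solve 4 (λ b u a u′ → (b :- u′ :* a) :- (b :- u :* a) := (u :- u′) :* a) refl (b′ k) u (a k) u′)
                    (J-sub (b′≡u′a k) (J-resp (+-congʳ (b≋b′ k)) (b≡ua k))))
       in u≡u′ , (λ k → +-cong (b≋b′ k) (-‿cong (*-congʳ (rep-cong u≡u′)))))
    (λ ((b , _) , (u , _ , _)) ((b′ , _) , (u′ , _ , _)) (u≡u′ , b-ua≋) k → begin
       b k                               ≈⟨ solve 2 (λ b s → b := (b :- s) :+ s) refl (b k) (rep u * a k) ⟩
       (b k - rep u * a k) + rep u * a k    ≈⟨ +-cong (b-ua≋ k) (*-congʳ (rep-cong u≡u′)) ⟩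
       (b′ k - rep u′ * a k) + rep u′ * a k ≈⟨ solve 2 (λ b s → (b :- s) :+ s := b) refl (b′ k) (rep u′ * a k) ⟩
       b′ k                              ∎)
    (λ ((u , j) , (u-unit , Jj)) →
       let s = rep u
           s-unit : Unit s
           s-unit = Unit-resp (solve 2 (λ u s → u :+ (s :- u) := s) refl u s) (Unit-+J u-unit (representative-class u))
           y : K²ᵉ
           y k = s * a k + j k
           y-unimod : Unimodular K e y
           y-unimod = ¬J-vector⇒Unimodular (λ Jy → let (i , unit) = a-unimod in
             J⇒¬Unit (J-resp (solve 2 (λ x j → (x :+ j) :- j := x) refl (s * a i) (j i)) (J-sub (Jy i) (Jj i))) (Unit-* s-unit unit))
           rep-s≡s : rep s ≡ s
           rep-s≡s = ≡.cong representative (class-representative (class u))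
       in ((y , y-unimod) , s , s-unit , (λ k → J-resp (solve 2 (λ x j → j := (x :+ j) :- x) refl (s * a k) (j k)) (Jj k))) ,
          representative-class u ,
          (λ k → trans (+-congˡ (-‿cong (*-congʳ (reflexive rep-s≡s)))) (solve 2 (λ x j → (x :+ j) :- x := j) refl (s * a k) (j k))))
    (count-× Unit/J-count J-vector-count)
    where
    rep : Carrier → Carrier
    rep u = representative (class u)
    rep-cong : ∀ {u u′} → u ≡J u′ → rep u ≈ rep u′
    rep-cong u≡u′ = reflexive (≡.cong representative (class-resp u≡u′))

  class-size : ∀ x → Σ ℕ λ n → Count _∼_ (SameClass x) n × n *ℕ (q *ℕ (q ∸ 1)) ≡ (q ∸ 1) *ℕ q ^ℕ (e +ℕ e)
  class-size x = count-points (SameClass x)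
    (λ y y′ y∼y′ x≈y → IsEquivalence.trans SameClass-isEquivalence {x} {y} {y′} x≈y (∼⇒SameClass {y} {y′} y∼y′))
    (class-vector-count x)

module CommonNeighbours {c ℓ} (K : CommutativeRing c ℓ) (N : ℕ) (K-finite : HasSize K N)
  (J : CommutativeRing.Carrier K → Set ℓ) (three : ExactlyThreeIdeals K J)
  (q : ℕ) (K/J-size : QuotientSize K J q) (e : ℕ) where

  open import Data.Fin as Fin using (Fin)
  open import Data.Nat using (_∸_) renaming (_*_ to _*ℕ_; _+_ to _+ℕ_; _^_ to _^ℕ_)
  open CommutativeRing K
  open IntegerCoefficientSolver K using (solve; _:=_; _:+_; _:-_; :-_; con)
  open import Relation.Binary.Reasoning.Setoid setoid
  open import Data.Integer using (+_)
  open Counting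
  open ThreeIdealRing K N K-finite J three
  open ThreeIdealRingCounts K N K-finite J three q K/J-size
  open SymplecticForm K e
  open UnimodularVectors K N K-finite J three e
  open UnimodularVectorCounts K N K-finite J three q K/J-size e
  open Points K N K-finite J three q K/J-size e

  CommonNeighbour : Point → Point → Point → Set ℓ
  CommonNeighbour x y z = Adjacent x z × Adjacent y z

  CommonNeighbour-resp : ∀ x y z z′ → z ∼ z′ → CommonNeighbour x y z → CommonNeighbour x y z′
  CommonNeighbour-resp x y z z′ z∼z′ (xz , yz) = Adjacent-resp x z z′ z∼z′ xz , Adjacent-resp y z z′ z∼z′ yz

  ≉0-resp : ∀ {x x′} → x ≈ x′ → ¬ x ≈ 0# → ¬ x′ ≈ 0#
  ≉0-resp x≈x′ x≉0 x′≈0 = x≉0 (trans x≈x′ x′≈0)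

  -- c₀ and d₀ are the sizes of {a, w}⊥ in K²ᵉ and in J²ᵉ for the independent pair (a, w) used.
  record CoordinateCount {p} (n-Π n-JΠ : ℕ) (P : Point → Set p) : Set (c ⊔ ℓ ⊔ p) where
    field
      size c₀ d₀ : ℕ
      count      : Count _∼_ P size
      c₀-spec    : ((q *ℕ q) *ℕ (q *ℕ q)) *ℕ c₀ ≡ (q *ℕ q) ^ℕ (e +ℕ e)
      d₀-spec    : (q *ℕ q) *ℕ d₀ ≡ q ^ℕ (e +ℕ e)
      size-spec  : n-JΠ *ℕ d₀ +ℕ size *ℕ (q *ℕ (q ∸ 1)) ≡ n-Π *ℕ c₀

  coordinate-count : ∀ {a w} → Independent a w → ∀ {p π} (P : Point → Set p) → (∀ x y → x ∼ y → P x → P y) →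
    (Π : Carrier → Carrier → Set π) → (∀ {x x′ y y′} → x ≈ x′ → y ≈ y′ → Π x y → Π x′ y′) →
    (∀ z → P z → Π ⟪ a , proj₁ z ⟫ ⟪ w , proj₁ z ⟫) → (∀ z → Π ⟪ a , proj₁ z ⟫ ⟪ w , proj₁ z ⟫ → P z) →
    ∀ {n-Π n-JΠ} → Count _≈²_ (λ (x , y) → (Univ x × Univ y) × Π x y) n-Π →
    Count _≈²_ (λ (x , y) → (J x × J y) × Π x y) n-JΠ → CoordinateCount n-Π n-JΠ P
  coordinate-count {a} {w} independent P P-resp Π Π-resp P⇒Π Π⇒P {n-JΠ = n-JΠ} c-Π c-JΠ =
    let (n , c-vectors , n-spec) = count-unimodular-by Π Π-resp c-Π c-JΠ
        (m , c-points , m*U≡n) = count-points P P-resp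
          (count-⇔ (λ _ _ → refl) P⇒Π Π⇒P (vectors→points (λ z → Π ⟪ a , z ⟫ ⟪ w , z ⟫) c-vectors))
    in record
      { size = m ; c₀ = c₀ ; d₀ = d₀ ; count = c-points ; c₀-spec = c₀-spec ; d₀-spec = d₀-spec
      ; size-spec = ≡.trans (≡.cong (n-JΠ *ℕ d₀ +ℕ_) m*U≡n) n-spec }
    where open Coordinates independent

  ε-independent : ∀ a k → Unit (a k) → ∀ m → k ≢ m → Independent a (ε m)
  ε-independent a k ak-unit m k≢m with proportional-or-independent a (ε m) (k , ak-unit)
  ... | inj₂ independent = independent
  ... | inj₁ (r , ε≡ra)  = ⊥-elim (J⇒¬Unit J-1# Unit-1#)
    where
    J-r : J r
    J-r = ¬Unit⇒J (λ r-unit → J⇒¬Unit (J-resp r·ak≈ (J-neg (ε≡ra k))) (Unit-* r-unit ak-unit))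
      where
      r·ak≈ : - (ε m k - r * a k) ≈ r * a k
      r·ak≈ = trans (-‿cong (+-congʳ (ε-off-diagonal m k k≢m))) (solve 1 (λ x → :- (con (+ 0) :- x) := x) refl _)
    J-1# : J 1#
    J-1# = J-resp (trans (solve 2 (λ x y → (x :- y) :+ y := x) refl (ε m m) (r * a m)) (ε-diagonal m))
                  (J-+ (ε≡ra m) (J-*ʳ (a m) J-r))

  independent-partner : ∀ (i₀ i₁ : Fin (e +ℕ e)) → i₀ ≢ i₁ → ∀ a → Unimodular K e a → Σ K²ᵉ (Independent a)
  independent-partner i₀ i₁ i₀≢i₁ a (k , ak-unit) with k Fin.≟ i₀
  ... | yes ≡.refl = ε i₁ , ε-independent a k ak-unit i₁ i₀≢i₁
  ... | no k≢i₀    = ε i₀ , ε-independent a k ak-unit i₀ k≢i₀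

  degree : ∀ (i₀ i₁ : Fin (e +ℕ e)) → i₀ ≢ i₁ → ∀ x →
    CoordinateCount ((q *ℕ q ∸ 1) *ℕ (q *ℕ q)) ((q ∸ 1) *ℕ q) (Adjacent x)
  degree i₀ i₁ i₀≢i₁ x@(a , a-unimod) =
    coordinate-count (proj₂ (independent-partner i₀ i₁ i₀≢i₁ a a-unimod)) (Adjacent x) (Adjacent-resp x)
      (λ s _ → ¬ s ≈ 0#) (λ s≈ _ → ≉0-resp s≈) (λ _ adj → adj) (λ _ adj → adj)
      (count-⇔ ≈²-refl (λ _ (_ , s≉0) → s≉0 , tt) (λ _ (s≉0 , _) → (tt , tt) , s≉0) (count-× ≉0-count K-count))
      (count-⇔ ≈²-refl (λ _ ((js , js′) , s≉0) → (js , s≉0) , js′) (λ _ ((js , s≉0) , js′) → (js , js′) , s≉0)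
        (count-× J≉0-count J-count))

  common-neighbours-other-class : ∀ x y → ¬ SameClass x y →
    CoordinateCount ((q *ℕ q ∸ 1) *ℕ (q *ℕ q ∸ 1)) ((q ∸ 1) *ℕ (q ∸ 1)) (CommonNeighbour x y)
  common-neighbours-other-class x@(a , a-unimod) y@(b , b-unimod) ¬same
    with proportional-or-independent a b a-unimod
  ... | inj₁ (r , b≡ra) = ⊥-elim (¬same (r , ¬J⇒Unit J-r⇒J-b , b≡ra))
    where
    J-r⇒J-b : ¬ J r
    J-r⇒J-b jr = Unimodular⇒¬J-vector b-unimod (λ k →
      J-resp (solve 2 (λ b x → (b :- x) :+ x := b) refl (b k) (r * a k)) (J-+ (b≡ra k) (J-*ʳ (a k) jr)))
  ... | inj₂ independent =
    coordinate-count independent (CommonNeighbour x y) (CommonNeighbour-resp x y) Both≉0 Both≉0-resp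
      (λ _ n → n) (λ _ n → n)
      (count-⇔ ≈²-refl (λ _ → proj₂) (λ _ n → (tt , tt) , n) (count-× ≉0-count ≉0-count))
      (count-⇔ ≈²-refl (λ _ ((js , js′) , (s≉0 , s′≉0)) → (js , s≉0) , (js′ , s′≉0))
                       (λ _ ((js , s≉0) , (js′ , s′≉0)) → (js , js′) , (s≉0 , s′≉0))
        (count-× J≉0-count J≉0-count))
    where
    Both≉0 : Carrier → Carrier → Set ℓ
    Both≉0 s s′ = ¬ s ≈ 0# × ¬ s′ ≈ 0#
    Both≉0-resp : ∀ {s s₁ s′ s′₁} → s ≈ s₁ → s′ ≈ s′₁ → Both≉0 s s′ → Both≉0 s₁ s′₁
    Both≉0-resp s≈ s′≈ (s≉0 , s′≉0) = ≉0-resp s≈ s≉0 , ≉0-resp s′≈ s′≉0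

  module SameClassPairs (u : Carrier) (u-unit : Unit u) where

    Π₁ : Carrier → Carrier → Set ℓ
    Π₁ s s′ = ¬ s ≈ 0# × ¬ u * s + t * s′ ≈ 0#

    Π₁-resp : ∀ {s s₁ s′ s′₁} → s ≈ s₁ → s′ ≈ s′₁ → Π₁ s s′ → Π₁ s₁ s′₁
    Π₁-resp s≈ s′≈ (s≉0 , us+ts′≉0) = ≉0-resp s≈ s≉0 , ≉0-resp (+-cong (*-congˡ s≈) (*-congˡ s′≈)) us+ts′≉0

    -- For x ∈ J, the solutions y of u x + t y = 0 form the coset y₀ + J, where t y₀ = - u x.
    solution-count : ∀ {x} → J x → Count _≈_ (λ y → Univ y × u * x + t * y ≈ 0#) q
    solution-count {x} jx = count-bijection {S = _≈_} {Q = J}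
      (λ (y , _ , ux+ty≈0) → y - y₀ , t*-injective (trans
          (solve 2 (λ ux ty → ty := :- ux :+ (ux :+ ty)) refl (u * x) (t * y)) (trans (+-cong y₀-spec ux+ty≈0) (+-identityʳ _))))
      (λ _ _ y≈y′ → +-congʳ y≈y′)
      (λ (y , _) (y′ , _) y-y₀≈ → trans (solve 2 (λ y y₀ → y := (y :- y₀) :+ y₀) refl y y₀)
          (trans (+-congʳ y-y₀≈) (solve 2 (λ y y₀ → (y :- y₀) :+ y₀ := y) refl y′ y₀)))
      (λ (j , jj) → (j + y₀ , tt , (begin
          u * x + t * (j + y₀)       ≈⟨ +-congˡ (distribˡ t j y₀) ⟩
          u * x + (t * j + t * y₀)   ≈⟨ +-congˡ (+-cong (J*J≈0 J-t jj) (sym y₀-spec)) ⟩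
          u * x + (0# + - (u * x))   ≈⟨ solve 1 (λ x → x :+ (con (+ 0) :+ :- x) := con (+ 0)) refl (u * x) ⟩
          0#                         ∎)) , solve 2 (λ j y₀ → (j :+ y₀) :- y₀ := j) refl j y₀)
      J-count
      where
      y₀ : Carrier
      y₀ = proj₁ (J⊆tK (J-neg (J-*ˡ u jx)))
      y₀-spec : - (u * x) ≈ t * y₀
      y₀-spec = proj₂ (J⊆tK (J-neg (J-*ˡ u jx)))

    non-solution-count : ∀ {x} → J x → Count _≈_ (λ y → ¬ u * x + t * y ≈ 0#) (q *ℕ (q ∸ 1))
    non-solution-count {x} jx = ≡.subst (Count _≈_ _) q*q∸q≡q*[q∸1]
      (count-⇔ (λ _ → refl) (λ _ ≉0 → tt , ≉0) (λ _ → proj₂)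
        (count-complement isEquivalence K-count (λ y → u * x + t * y ≈ 0#) (λ y → (u * x + t * y) ≈? 0#)
          (λ y y′ y≈y′ ≈0 → trans (+-congˡ (*-congˡ (sym y≈y′))) ≈0) (solution-count jx)))

    J-part-count : Count _≈²_ (λ (x , y) → (J x × ¬ x ≈ 0#) × ¬ u * x + t * y ≈ 0#) ((q ∸ 1) *ℕ (q *ℕ (q ∸ 1)))
    J-part-count = count-fibres ≈²-refl (λ ((x , _) , (x∈ , _)) → Count.f J≉0-count (x , x∈))
      (λ ((x , _) , (x∈ , _)) ((x′ , _) , (x′∈ , _)) (x≈x′ , _) → Count.resp J≉0-count (x , x∈) (x′ , x′∈) x≈x′)
      fibre
      where
      fibre : ∀ i → Count _≈²_ (λ (x , y) → Σ ((J x × ¬ x ≈ 0#) × ¬ u * x + t * y ≈ 0#) λ p →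
                                       Count.f J≉0-count (x , proj₁ p) ≡ i) (q *ℕ (q ∸ 1))
      fibre i = count-bijection {S = _≈_} {Q = λ y → ¬ u * xᵢ + t * y ≈ 0#}
        (λ ((x , y) , ((x∈ , ≉0) , fx≡i)) → y , ≉0-resp (+-congʳ (*-congˡ (x≈xᵢ x x∈ fx≡i))) ≉0)
        (λ _ _ (_ , y≈y′) → y≈y′)
        (λ ((x , _) , ((x∈ , _) , fx≡i)) ((x′ , _) , ((x′∈ , _) , fx′≡i)) y≈y′ →
           trans (x≈xᵢ x x∈ fx≡i) (sym (x≈xᵢ x′ x′∈ fx′≡i)) , y≈y′)
        (λ (y , ≉0) → ((xᵢ , y) , ((xᵢ∈ , ≉0) , f-xᵢ)) , refl)
        (non-solution-count (proj₁ xᵢ∈))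
        where
        xᵢ : Carrier
        xᵢ = proj₁ (proj₁ (Count.surj J≉0-count i))
        xᵢ∈ : J xᵢ × ¬ xᵢ ≈ 0#
        xᵢ∈ = proj₂ (proj₁ (Count.surj J≉0-count i))
        f-xᵢ : Count.f J≉0-count (xᵢ , xᵢ∈) ≡ i
        f-xᵢ = proj₂ (Count.surj J≉0-count i)
        x≈xᵢ : ∀ x x∈ → Count.f J≉0-count (x , x∈) ≡ i → x ≈ xᵢ
        x≈xᵢ x x∈ fx≡i = Count.inj J≉0-count (x , x∈) (xᵢ , xᵢ∈) (≡.trans fx≡i (≡.sym f-xᵢ))

    -- If x is a unit then so is u x + t y, for every y.
    pair-count : Count _≈²_ (λ (x , y) → (Univ x × Univ y) × Π₁ x y)
                            ((q *ℕ (q ∸ 1)) *ℕ (q *ℕ q) +ℕ (q ∸ 1) *ℕ (q *ℕ (q ∸ 1)))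
    pair-count = count-⇔ ≈²-refl to from
      (count-⊎ (count-× Unit-count K-count) J-part-count
        (λ _ _ (x≈x′ , _) (x-unit , _) ((jx′ , _) , _) → J⇒¬Unit jx′ (Unit-resp x≈x′ x-unit))
        (λ _ _ (x≈x′ , _) ((jx , _) , _) (x′-unit , _) → J⇒¬Unit jx (Unit-resp (sym x≈x′) x′-unit)))
      where
      split : ∀ x y → Π₁ x y → Dec (Unit x) → (Unit x × Univ y) ⊎ ((J x × ¬ x ≈ 0#) × ¬ u * x + t * y ≈ 0#)
      split x y _               (yes x-unit) = inj₁ (x-unit , tt)
      split x y (x≉0 , ≉0)      (no ¬unit)   = inj₂ ((¬Unit⇒J ¬unit , x≉0) , ≉0)
      to : ∀ xy → (Univ (proj₁ xy) × Univ (proj₂ xy)) × Π₁ (proj₁ xy) (proj₂ xy) → _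
      to (x , y) (_ , π) = split x y π (Unit? x)
      from : ∀ xy → (Unit (proj₁ xy) × Univ (proj₂ xy)) ⊎ ((J (proj₁ xy) × ¬ proj₁ xy ≈ 0#) × ¬ u * proj₁ xy + t * proj₂ xy ≈ 0#) →
             (Univ (proj₁ xy) × Univ (proj₂ xy)) × Π₁ (proj₁ xy) (proj₂ xy)
      from (x , y) (inj₁ (x-unit , _))    = (tt , tt) , Unit⇒≉0 x-unit , Unit⇒≉0 (Unit-+J (Unit-* u-unit x-unit) (J-t* y))
      from (x , y) (inj₂ ((_ , x≉0) , ≉0)) = (tt , tt) , x≉0 , ≉0

    -- For x, y ∈ J we have t y = 0, so u x + t y = u x.
    J-pair-count : Count _≈²_ (λ (x , y) → (J x × J y) × Π₁ x y) ((q ∸ 1) *ℕ q)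
    J-pair-count = count-⇔ ≈²-refl (λ _ ((jx , jy) , (x≉0 , _)) → (jx , x≉0) , jy)
      (λ (x , y) ((jx , x≉0) , jy) → (jx , jy) , x≉0 ,
         λ ux+ty≈0 → x≉0 (Unit-cancelˡ u-unit (trans (trans (sym (+-identityʳ _)) (trans (+-congˡ (sym (J*J≈0 J-t jy))) ux+ty≈0))
                                                    (sym (zeroʳ u)))))
      (count-× J≉0-count J-count)

  private
    λ₁-pairs λ₁-J-pairs : ℕ
    λ₁-pairs = (q *ℕ (q ∸ 1)) *ℕ (q *ℕ q) +ℕ (q ∸ 1) *ℕ (q *ℕ (q ∸ 1))
    λ₁-J-pairs = (q ∸ 1) *ℕ q

  common-neighbours-of-sum : ∀ x y → ¬ x ∼ y → ∀ u → Unit u → ∀ w → proj₁ y ≋ (λ k → u * proj₁ x k + t * w k) →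
    CoordinateCount λ₁-pairs λ₁-J-pairs (CommonNeighbour x y)
  common-neighbours-of-sum x@(a , a-unimod) y@(b , _) ¬x∼y u u-unit w b≈ua+tw
    with proportional-or-independent a w a-unimod
  ... | inj₁ (r , w≡ra) = ⊥-elim (¬x∼y (IsEquivalence.sym ∼-isEquivalence {y} {x}
    (u + t * r , Unit-+J u-unit (J-t* r) , λ k → trans (b≈ua+tw k)
       (trans (+-congˡ (trans (t*-cong (w≡ra k)) (sym (*-assoc t r (a k))))) (sym (distribʳ (a k) u (t * r)))))))
  ... | inj₂ independent =
    coordinate-count independent (CommonNeighbour x y) (CommonNeighbour-resp x y) Π₁ Π₁-resp
      (λ (z , _) (az≉0 , bz≉0) → az≉0 , ≉0-resp (⟪b,-⟫≈ z) bz≉0)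
      (λ (z , _) (az≉0 , ≉0) → az≉0 , ≉0-resp (sym (⟪b,-⟫≈ z)) ≉0)
      pair-count J-pair-count
    where
    open SameClassPairs u u-unit
    ⟪b,-⟫≈ : ∀ z → ⟪ b , z ⟫ ≈ u * ⟪ a , z ⟫ + t * ⟪ w , z ⟫
    ⟪b,-⟫≈ z = trans (⟪⟫-cong {z = z} b≈ua+tw (λ _ → refl)) (⟪⟫-linearˡ u a t w z)

  common-neighbours-same-class : ∀ x y → ¬ x ∼ y → SameClass x y →
    CoordinateCount λ₁-pairs λ₁-J-pairs (CommonNeighbour x y)
  common-neighbours-same-class x@(a , _) y@(b , _) ¬x∼y (u , u-unit , b≡ua) =
    common-neighbours-of-sum x y ¬x∼y u u-unit (λ k → proj₁ (J⊆tK (b≡ua k))) λ k →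
      trans (solve 2 (λ b x → b := x :+ (b :- x)) refl (b k) (u * a k)) (+-congˡ (proj₂ (J⊆tK (b≡ua k))))

-- Arithmetic for q = 2 + p′ and e = 2 + e′; every power of q that occurs is q ^ a * X ^ b with X = q ^ e′.
module Arithmetic (p′ e′ : ℕ) where

  open import Data.Nat
  open import Data.Nat.Properties
  open import Data.Nat.DivMod using (_/_; m*n/n≡m)
  open import Data.Nat.Tactic.RingSolver using (solve-∀)
  open import Data.Nat.Solver using (module +-*-Solver)
  open +-*-Solver using (solve; _:+_; _:*_; _:^_; _:=_; con)
  open ≡ using (refl; sym; trans; cong; cong₂)
  open ≡.≡-Reasoning

  q p e X : ℕ
  q = 2 + p′
  p = 1 + p′
  e = 2 + e′
  X = q ^ e′

  Q : ℕ → ℕ → ℕ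
  Q a b = q ^ a * X ^ b

  Q≢0 : ∀ a b → NonZero (Q a b)
  Q≢0 a b = m*n≢0 (q ^ a) (X ^ b) {{m^n≢0 q a}} {{m^n≢0 X b {{m^n≢0 q e′}}}}

  q^≡Q : ∀ {E} a b → E ≡ a + b * e′ → q ^ E ≡ Q a b
  q^≡Q {E} a b E≡ = begin
    q ^ E                ≡⟨ cong (q ^_) E≡ ⟩
    q ^ (a + b * e′)     ≡⟨ ^-distribˡ-+-* q a (b * e′) ⟩
    q ^ a * q ^ (b * e′) ≡⟨ cong (λ n → q ^ a * q ^ n) (*-comm b e′) ⟩
    q ^ a * q ^ (e′ * b) ≡⟨ cong (q ^ a *_) (sym (^-*-assoc q e′ b)) ⟩
    Q a b                ∎

  q^[e+e] : q ^ (e + e) ≡ Q 4 2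
  q^[e+e] = q^≡Q 4 2 (exponent e′)
    where
    exponent : ∀ n → (2 + n) + (2 + n) ≡ 4 + 2 * n
    exponent = solve-∀

  [q*q]^[e+e] : (q * q) ^ (e + e) ≡ Q 8 4
  [q*q]^[e+e] = begin
    (q * q) ^ (e + e)   ≡⟨ cong (λ r → (q * r) ^ (e + e)) (sym (*-identityʳ q)) ⟩
    (q ^ 2) ^ (e + e)   ≡⟨ ^-*-assoc q 2 (e + e) ⟩
    q ^ (2 * (e + e))   ≡⟨ q^≡Q 8 4 (exponent e′) ⟩
    Q 8 4               ∎
    where
    exponent : ∀ n → 2 * ((2 + n) + (2 + n)) ≡ 8 + 4 * n
    exponent = solve-∀

  q^[2e∸_] : ∀ j {a} → j + a ≡ 4 → q ^ (2 * e ∸ j) ≡ Q a 2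
  q^[2e∸ j ] {a} j+a≡4 = q^≡Q a 2 (trans (cong (_∸ j) 2e≡) (m+n∸m≡n j (a + 2 * e′)))
    where
    expand : ∀ n → 2 * (2 + n) ≡ 4 + 2 * n
    expand = solve-∀
    2e≡ : 2 * e ≡ j + (a + 2 * e′)
    2e≡ = trans (expand e′) (trans (cong (_+ 2 * e′) (sym j+a≡4)) (+-assoc j a (2 * e′)))

  q^[4e∸_] : ∀ j {a} → j + a ≡ 8 → q ^ (4 * e ∸ j) ≡ Q a 4
  q^[4e∸ j ] {a} j+a≡8 = q^≡Q a 4 (trans (cong (_∸ j) 4e≡) (m+n∸m≡n j (a + 4 * e′)))
    where
    expand : ∀ n → 4 * (2 + n) ≡ 8 + 4 * n
    expand = solve-∀
    4e≡ : 4 * e ≡ j + (a + 4 * e′)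
    4e≡ = trans (expand e′) (trans (cong (_+ 4 * e′) (sym j+a≡8)) (+-assoc j a (4 * e′)))

  q^[2e] : q ^ (2 * e) ≡ Q 4 2
  q^[2e] = q^[2e∸ 0 ] refl

  q^[2e∸1] : q ^ (2 * e ∸ 1) ≡ Q 3 2
  q^[2e∸1] = q^[2e∸ 1 ] refl

  c₀≡ : ∀ {c₀} → ((q * q) * (q * q)) * c₀ ≡ (q * q) ^ (e + e) → c₀ ≡ Q 4 4
  c₀≡ {c₀} spec = *-cancelˡ-≡ c₀ (Q 4 4) ((q * q) * (q * q)) {{m*n≢0 (q * q) (q * q)}}
    (trans spec (trans [q*q]^[e+e] (solve 2 (λ q X → q :^ 8 :* X :^ 4 := (q :* q) :* (q :* q) :* (q :^ 4 :* X :^ 4)) refl q X)))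

  d₀≡ : ∀ {d₀} → (q * q) * d₀ ≡ q ^ (e + e) → d₀ ≡ Q 2 2
  d₀≡ {d₀} spec = *-cancelˡ-≡ d₀ (Q 2 2) (q * q)
    (trans spec (trans q^[e+e] (solve 2 (λ q X → q :^ 4 :* X :^ 2 := (q :* q) :* (q :^ 2 :* X :^ 2)) refl q X)))

  private
    vp+Q32≡ : ∀ {v M} → q ^ (e + e) + M ≡ (q * q) ^ (e + e) → v * (q * p) ≡ M → v * p + Q 3 2 ≡ Q 3 2 * Q 4 2
    vp+Q32≡ {v} {M} M-spec v-spec = *-cancelʳ-≡ (v * p + Q 3 2) (Q 3 2 * Q 4 2) q (begin
      (v * p + Q 3 2) * q  ≡⟨ expand v p′ X ⟩
      v * (q * p) + Q 4 2  ≡⟨ cong (_+ Q 4 2) v-spec ⟩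
      M + Q 4 2            ≡⟨ +-comm M _ ⟩
      Q 4 2 + M            ≡⟨ cong (_+ M) (sym q^[e+e]) ⟩
      q ^ (e + e) + M      ≡⟨ M-spec ⟩
      (q * q) ^ (e + e)    ≡⟨ [q*q]^[e+e] ⟩
      Q 8 4                ≡⟨ solve 2 (λ q X → q :^ 8 :* X :^ 4 := q :^ 3 :* X :^ 2 :* (q :^ 4 :* X :^ 2) :* q) refl q X ⟩
      Q 3 2 * Q 4 2 * q    ∎)
      where
      expand : ∀ v r X → (v * (1 + r) + (2 + r) ^ 3 * X ^ 2) * (2 + r) ≡ v * ((2 + r) * (1 + r)) + (2 + r) ^ 4 * X ^ 2
      expand = solve 3 (λ v r X → let q = con 2 :+ r ; p = con 1 :+ r in
        (v :* p :+ q :^ 3 :* X :^ 2) :* q := v :* (q :* p) :+ q :^ 4 :* X :^ 2) refl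

  point-count-formula : ∀ {v M} → q ^ (e + e) + M ≡ (q * q) ^ (e + e) → v * (q * p) ≡ M →
    v ≡ (q ^ (2 * e ∸ 1) * (q ^ (2 * e) ∸ 1)) div (q ∸ 1)
  point-count-formula {v} M-spec v-spec = sym (begin
    (q ^ (2 * e ∸ 1) * (q ^ (2 * e) ∸ 1)) / p ≡⟨ cong (λ n → n / p) numerator ⟩
    (v * p) / p                                ≡⟨ m*n/n≡m v p ⟩
    v                                          ∎)
    where
    numerator : q ^ (2 * e ∸ 1) * (q ^ (2 * e) ∸ 1) ≡ v * p
    numerator = begin
      q ^ (2 * e ∸ 1) * (q ^ (2 * e) ∸ 1)  ≡⟨ cong₂ (λ a b → a * (b ∸ 1)) q^[2e∸1] q^[2e] ⟩
      Q 3 2 * (Q 4 2 ∸ 1)                  ≡⟨ *-distribˡ-∸ (Q 3 2) (Q 4 2) 1 ⟩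
      Q 3 2 * Q 4 2 ∸ Q 3 2 * 1            ≡⟨ cong (Q 3 2 * Q 4 2 ∸_) (*-identityʳ (Q 3 2)) ⟩
      Q 3 2 * Q 4 2 ∸ Q 3 2                ≡⟨ cong (_∸ Q 3 2) (sym (vp+Q32≡ {v} M-spec v-spec)) ⟩
      v * p + Q 3 2 ∸ Q 3 2                ≡⟨ m+n∸n≡m (v * p) (Q 3 2) ⟩
      v * p                                ∎

  class-size-formula : ∀ {n} → n * (q * p) ≡ p * q ^ (e + e) → n ≡ q ^ (2 * e ∸ 1)
  class-size-formula {n} n-spec = trans (*-cancelʳ-≡ n (Q 3 2) (q * p) (begin
    n * (q * p)      ≡⟨ n-spec ⟩
    p * q ^ (e + e)  ≡⟨ cong (p *_) q^[e+e] ⟩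
    p * Q 4 2        ≡⟨ regroup p′ X ⟩
    Q 3 2 * (q * p)  ∎)) (sym q^[2e∸1])
    where
    regroup : ∀ r X → (1 + r) * ((2 + r) ^ 4 * X ^ 2) ≡ (2 + r) ^ 3 * X ^ 2 * ((2 + r) * (1 + r))
    regroup = solve 2 (λ r X → let q = con 2 :+ r ; p = con 1 :+ r in
      p :* (q :^ 4 :* X :^ 2) := q :^ 3 :* X :^ 2 :* (q :* p)) refl

  class-count-formula : ∀ {m v M} → q ^ (e + e) + M ≡ (q * q) ^ (e + e) → v * (q * p) ≡ M → m * q ^ (2 * e ∸ 1) ≡ v →
    m ≡ (q ^ (2 * e) ∸ 1) div (q ∸ 1)
  class-count-formula {m} {v} M-spec v-spec m-spec = sym (begin
    (q ^ (2 * e) ∸ 1) / p  ≡⟨ cong (λ n → (n ∸ 1) / p) q^[2e] ⟩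
    (Q 4 2 ∸ 1) / p        ≡⟨ cong (λ n → (n ∸ 1) / p) (sym mp+1≡Q42) ⟩
    (m * p + 1 ∸ 1) / p    ≡⟨ cong (_/ p) (m+n∸n≡m (m * p) 1) ⟩
    (m * p) / p            ≡⟨ m*n/n≡m m p ⟩
    m                      ∎)
    where
    mp+1≡Q42 : m * p + 1 ≡ Q 4 2
    mp+1≡Q42 = *-cancelˡ-≡ (m * p + 1) (Q 4 2) (Q 3 2) {{Q≢0 3 2}} (begin
      Q 3 2 * (m * p + 1)    ≡⟨ expand (Q 3 2) m p ⟩
      (m * Q 3 2) * p + Q 3 2 ≡⟨ cong (λ n → (m * n) * p + Q 3 2) (sym q^[2e∸1]) ⟩
      (m * q ^ (2 * e ∸ 1)) * p + Q 3 2 ≡⟨ cong (λ n → n * p + Q 3 2) m-spec ⟩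
      v * p + Q 3 2           ≡⟨ vp+Q32≡ {v} M-spec v-spec ⟩
      Q 3 2 * Q 4 2           ∎)
      where
      expand : ∀ a b c → a * (b * c + 1) ≡ b * a * c + a
      expand = solve-∀

  -- The last hypothesis says n-Π c₀ = n-JΠ d₀ + (A - B) q p, with both sides moved so that no
  -- subtraction occurs.
  coordinate-count-formula : ∀ {n c₀ d₀} (n-Π n-JΠ A B : ℕ) →
    ((q * q) * (q * q)) * c₀ ≡ (q * q) ^ (e + e) → (q * q) * d₀ ≡ q ^ (e + e) →
    n-JΠ * d₀ + n * (q * p) ≡ n-Π * c₀ →
    n-Π * Q 4 4 + B * (q * p) ≡ A * (q * p) + n-JΠ * Q 2 2 → n ≡ A ∸ B
  coordinate-count-formula {n} {c₀} {d₀} n-Π n-JΠ A B c₀-spec d₀-spec n-spec identity =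
    trans (sym (m+n∸n≡m n B)) (cong (_∸ B) (*-cancelʳ-≡ (n + B) A (q * p) (+-cancelʳ-≡ (n-JΠ * Q 2 2) _ _ (begin
      (n + B) * (q * p) + n-JΠ * Q 2 2        ≡⟨ regroup n B (q * p) (n-JΠ * Q 2 2) ⟩
      (n-JΠ * Q 2 2 + n * (q * p)) + B * (q * p) ≡⟨ cong (λ d → (n-JΠ * d + n * (q * p)) + B * (q * p)) (sym (d₀≡ d₀-spec)) ⟩
      (n-JΠ * d₀ + n * (q * p)) + B * (q * p)    ≡⟨ cong (_+ B * (q * p)) (trans n-spec (cong (n-Π *_) (c₀≡ c₀-spec))) ⟩
      n-Π * Q 4 4 + B * (q * p)                ≡⟨ identity ⟩
      A * (q * p) + n-JΠ * Q 2 2               ∎))))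
    where
    regroup : ∀ a b c d → (a + b) * c + d ≡ (d + a * c) + b * c
    regroup = solve-∀

  q*q∸1 : q * q ∸ 1 ≡ p * (2 + p)
  q*q∸1 = cong (_∸ 1) (expand p′)
    where
    expand : ∀ n → (2 + n) * (2 + n) ≡ 1 + (1 + n) * (2 + (1 + n))
    expand = solve-∀

  degree-formula : ∀ n c₀ d₀ → ((q * q) * (q * q)) * c₀ ≡ (q * q) ^ (e + e) → (q * q) * d₀ ≡ q ^ (e + e) →
    ((q ∸ 1) * q) * d₀ + n * (q * p) ≡ ((q * q ∸ 1) * (q * q)) * c₀ →
    n ≡ (q ^ (4 * e ∸ 2) + q ^ (4 * e ∸ 3)) ∸ q ^ (2 * e ∸ 2)
  degree-formula n c₀ d₀ c₀-spec d₀-spec n-spec =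
    trans (coordinate-count-formula {n} {c₀} {d₀} ((q * q ∸ 1) * (q * q)) ((q ∸ 1) * q) (Q 6 4 + Q 5 4) (Q 2 2)
             c₀-spec d₀-spec n-spec identity)
          (sym (cong₂ _∸_ (cong₂ _+_ (q^[4e∸ 2 ] refl) (q^[4e∸ 3 ] refl)) (q^[2e∸ 2 ] refl)))
    where
    identity : ((q * q ∸ 1) * (q * q)) * Q 4 4 + Q 2 2 * (q * p) ≡ (Q 6 4 + Q 5 4) * (q * p) + ((q ∸ 1) * q) * Q 2 2
    identity = trans (cong (λ z → (z * (q * q)) * Q 4 4 + Q 2 2 * (q * p)) q*q∸1)
      (solve 2 (λ r X → let q = con 2 :+ r ; p = con 1 :+ r ; Q a b = q :^ a :* X :^ b in
          ((p :* (con 2 :+ p)) :* (q :* q)) :* Q 4 4 :+ Q 2 2 :* (q :* p)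
        := (Q 6 4 :+ Q 5 4) :* (q :* p) :+ (p :* q) :* Q 2 2) refl p′ X)

  λ₁-formula : ∀ n c₀ d₀ → ((q * q) * (q * q)) * c₀ ≡ (q * q) ^ (e + e) → (q * q) * d₀ ≡ q ^ (e + e) →
    ((q ∸ 1) * q) * d₀ + n * (q * p) ≡ ((q * (q ∸ 1)) * (q * q) + (q ∸ 1) * (q * (q ∸ 1))) * c₀ →
    n ≡ (q ^ (4 * e ∸ 2) + q ^ (4 * e ∸ 3)) ∸ (q ^ (4 * e ∸ 4) + q ^ (2 * e ∸ 2))
  λ₁-formula n c₀ d₀ c₀-spec d₀-spec n-spec =
    trans (coordinate-count-formula {n} {c₀} {d₀} ((q * (q ∸ 1)) * (q * q) + (q ∸ 1) * (q * (q ∸ 1))) ((q ∸ 1) * q)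
             (Q 6 4 + Q 5 4) (Q 4 4 + Q 2 2) c₀-spec d₀-spec n-spec identity)
          (sym (cong₂ _∸_ (cong₂ _+_ (q^[4e∸ 2 ] refl) (q^[4e∸ 3 ] refl)) (cong₂ _+_ (q^[4e∸ 4 ] refl) (q^[2e∸ 2 ] refl))))
    where
    identity : ((q * (q ∸ 1)) * (q * q) + (q ∸ 1) * (q * (q ∸ 1))) * Q 4 4 + (Q 4 4 + Q 2 2) * (q * p)
             ≡ (Q 6 4 + Q 5 4) * (q * p) + ((q ∸ 1) * q) * Q 2 2
    identity = solve 2 (λ r X → let q = con 2 :+ r ; p = con 1 :+ r ; Q a b = q :^ a :* X :^ b in
        ((q :* p) :* (q :* q) :+ p :* (q :* p)) :* Q 4 4 :+ (Q 4 4 :+ Q 2 2) :* (q :* p)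
      := (Q 6 4 :+ Q 5 4) :* (q :* p) :+ (p :* q) :* Q 2 2) refl p′ X

  λ₂-formula : ∀ n c₀ d₀ → ((q * q) * (q * q)) * c₀ ≡ (q * q) ^ (e + e) → (q * q) * d₀ ≡ q ^ (e + e) →
    ((q ∸ 1) * (q ∸ 1)) * d₀ + n * (q * p) ≡ ((q * q ∸ 1) * (q * q ∸ 1)) * c₀ →
    n ≡ (q ^ (4 * e ∸ 2) + q ^ (4 * e ∸ 3) + q ^ (2 * e ∸ 3)) ∸ (q ^ (4 * e ∸ 4) + q ^ (4 * e ∸ 5) + q ^ (2 * e ∸ 2))
  λ₂-formula n c₀ d₀ c₀-spec d₀-spec n-spec =
    trans (coordinate-count-formula {n} {c₀} {d₀} ((q * q ∸ 1) * (q * q ∸ 1)) ((q ∸ 1) * (q ∸ 1))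
             (Q 6 4 + Q 5 4 + Q 1 2) (Q 4 4 + Q 3 4 + Q 2 2) c₀-spec d₀-spec n-spec identity)
          (sym (cong₂ _∸_ (cong₂ _+_ (cong₂ _+_ (q^[4e∸ 2 ] refl) (q^[4e∸ 3 ] refl)) (q^[2e∸ 3 ] refl))
                          (cong₂ _+_ (cong₂ _+_ (q^[4e∸ 4 ] refl) (q^[4e∸ 5 ] refl)) (q^[2e∸ 2 ] refl))))
    where
    identity : ((q * q ∸ 1) * (q * q ∸ 1)) * Q 4 4 + (Q 4 4 + Q 3 4 + Q 2 2) * (q * p)
             ≡ (Q 6 4 + Q 5 4 + Q 1 2) * (q * p) + ((q ∸ 1) * (q ∸ 1)) * Q 2 2
    identity = trans (cong (λ z → (z * z) * Q 4 4 + (Q 4 4 + Q 3 4 + Q 2 2) * (q * p)) q*q∸1)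
      (solve 2 (λ r X → let q = con 2 :+ r ; p = con 1 :+ r ; Q a b = q :^ a :* X :^ b in
          ((p :* (con 2 :+ p)) :* (p :* (con 2 :+ p))) :* Q 4 4 :+ (Q 4 4 :+ Q 3 4 :+ Q 2 2) :* (q :* p)
        := (Q 6 4 :+ Q 5 4 :+ Q 1 2) :* (q :* p) :+ (p :* p) :* Q 2 2) refl p′ X)

module DivisibleDesignGraph {c ℓ} (K : CommutativeRing c ℓ) (N : ℕ) (K-finite : HasSize K N)
  (J : CommutativeRing.Carrier K → Set ℓ) (three : ExactlyThreeIdeals K J)
  (p′ e′ : ℕ) (K/J-size : QuotientSize K J (2 ℕ.+ p′)) where

  open import Data.Fin as Fin using (Fin)
  open import Data.Nat using (_∸_; _+_; _*_; _^_)
  import Data.Nat.Properties as ℕₚ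
  open Counting
  open Arithmetic p′ e′
  open UnimodularVectorCounts K N K-finite J three q K/J-size e using (Unimodular-count)
  open Points K N K-finite J three q K/J-size e
  open CommonNeighbours K N K-finite J three q K/J-size e

  from-coordinates : ∀ {ℓ′ n-Π n-JΠ target} {P : Point → Set ℓ′} → CoordinateCount n-Π n-JΠ P →
    (∀ n c₀ d₀ → ((q * q) * (q * q)) * c₀ ≡ (q * q) ^ (e + e) → (q * q) * d₀ ≡ q ^ (e + e) →
       n-JΠ * d₀ + n * (q * p) ≡ n-Π * c₀ → n ≡ target) →
    Count _∼_ P target
  from-coordinates {P = P} cc size-formula = ≡.subst (Count _∼_ P) (size-formula size c₀ d₀ c₀-spec d₀-spec size-spec) count
    where open CoordinateCount cc

  v : ℕ
  v = (q ^ (2 * e ∸ 1) * (q ^ (2 * e) ∸ 1)) div (q ∸ 1)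

  private
    M-spec : q ^ (e + e) + proj₁ Unimodular-count ≡ (q * q) ^ (e + e)
    M-spec = proj₂ (proj₂ Unimodular-count)
    v₀ : ℕ
    v₀ = proj₁ Point-count

    v₀≡v : v₀ ≡ v
    v₀≡v = point-count-formula M-spec (proj₂ (proj₂ Point-count))

  point-count : Count _∼_ Univ v
  point-count = ≡.subst (Count _∼_ Univ) v₀≡v (proj₁ (proj₂ Point-count))

  class-count : ∀ x → Count _∼_ (SameClass x) (q ^ (2 * e ∸ 1))
  class-count x = let (n , c , n-spec) = class-size x in ≡.subst (Count _∼_ (SameClass x)) (class-size-formula n-spec) c

  private
    q^[2e∸1]-suc : Σ ℕ λ s → q ^ (2 * e ∸ 1) ≡ suc s
    q^[2e∸1]-suc with q ^ (2 * e ∸ 1) | ℕₚ.m^n≢0 q (2 * e ∸ 1)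
    ... | suc s | _ = s , ≡.refl

    classes : Σ ℕ λ m → Count SameClass Univ m × m * q ^ (2 * e ∸ 1) ≡ v
    classes = let (s , n≡) = q^[2e∸1]-suc
                  (m , c , m-spec) = count-quotient ∼-isEquivalence SameClass-isEquivalence (λ {x} {y} → ∼⇒SameClass {x} {y})
                    SameClass? s point-count
                    (λ x _ → ≡.subst (Count _∼_ _) n≡
                       (count-⇔ (λ z → IsEquivalence.refl ∼-isEquivalence {z}) (λ _ → proj₂) (λ _ same → tt , same) (class-count x)))
              in m , c , ≡.trans (≡.cong (m *_) n≡) m-spec

  m : ℕ
  m = (q ^ (2 * e) ∸ 1) div (q ∸ 1)

  class-index-count : Count SameClass Univ m
  class-index-count = let (m₀ , c , m₀-spec) = classes in
    ≡.subst (Count SameClass Univ) (class-count-formula M-spec (≡.subst (λ n → n * (q * p) ≡ proj₁ Unimodular-count) v₀≡v (proj₂ (proj₂ Point-count))) m₀-spec) c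

  cls : Point → Fin m
  cls x = Count.f class-index-count (x , tt)

  cls-size : ∀ i → Count _∼_ (λ x → cls x ≡ i) (q ^ (2 * e ∸ 1))
  cls-size i = count-⇔ (λ z → IsEquivalence.refl ∼-isEquivalence {z})
    (λ y clsy≡i → Count.inj class-index-count (xᵢ , tt) (y , tt) (≡.trans cls-xᵢ (≡.sym clsy≡i)))
    (λ y same → ≡.trans (≡.sym (Count.resp class-index-count (xᵢ , tt) (y , tt) same)) cls-xᵢ)
    (class-count xᵢ)
    where
    xᵢ : Point
    xᵢ = proj₁ (proj₁ (Count.surj class-index-count i))
    cls-xᵢ : cls xᵢ ≡ i
    cls-xᵢ = proj₂ (Count.surj class-index-count i)

  isDDG : IsDDG (_∼V_ K {e}) (AdjX K {e}) v
    ((q ^ (4 * e ∸ 2) + q ^ (4 * e ∸ 3)) ∸ q ^ (2 * e ∸ 2))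
    ((q ^ (4 * e ∸ 2) + q ^ (4 * e ∸ 3)) ∸ (q ^ (4 * e ∸ 4) + q ^ (2 * e ∸ 2)))
    ((q ^ (4 * e ∸ 2) + q ^ (4 * e ∸ 3) + q ^ (2 * e ∸ 3)) ∸ (q ^ (4 * e ∸ 4) + q ^ (4 * e ∸ 5) + q ^ (2 * e ∸ 2)))
    m (q ^ (2 * e ∸ 1))
  isDDG = record
    { adj-sym  = Adjacent-sym
    ; adj-irr  = Adjacent-irrefl
    ; order    = point-count
    ; regular  = λ x → from-coordinates (degree Fin.zero (Fin.suc Fin.zero) (λ ()) x) degree-formula
    ; cls      = cls
    ; cls-resp = λ x y x∼y → Count.resp class-index-count (x , tt) (y , tt) (∼⇒SameClass {x} {y} x∼y)
    ; cls-size = cls-size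
    ; same-cls = λ x y ¬x∼y same → from-coordinates
        (common-neighbours-same-class x y ¬x∼y (Count.inj class-index-count (x , tt) (y , tt) same)) λ₁-formula
    ; diff-cls = λ x y different → from-coordinates
        (common-neighbours-other-class x y (λ same → different (Count.resp class-index-count (x , tt) (y , tt) same)))
        λ₂-formula
    }

open import Data.Nat using (_+_; _*_; _∸_; _^_; _≤_; s≤s; z≤n)

theorem1p1 : ∀ {c ℓ} (e : ℕ) → 2 ≤ e →
    (K : CommutativeRing c ℓ) → (∃ λ N → HasSize K N) →
    (J : CommutativeRing.Carrier K → Set ℓ) → ExactlyThreeIdeals K J →
    (q : ℕ) → QuotientSize K J q →
    IsDDG (_∼V_ K {e}) (AdjX K {e})
      ((q ^ (2 * e ∸ 1) * (q ^ (2 * e) ∸ 1)) div (q ∸ 1))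
      ((q ^ (4 * e ∸ 2) + q ^ (4 * e ∸ 3)) ∸ q ^ (2 * e ∸ 2))
      ((q ^ (4 * e ∸ 2) + q ^ (4 * e ∸ 3)) ∸ (q ^ (4 * e ∸ 4) + q ^ (2 * e ∸ 2)))
      ((q ^ (4 * e ∸ 2) + q ^ (4 * e ∸ 3) + q ^ (2 * e ∸ 3))
        ∸ (q ^ (4 * e ∸ 4) + q ^ (4 * e ∸ 5) + q ^ (2 * e ∸ 2)))
      ((q ^ (2 * e) ∸ 1) div (q ∸ 1))
      (q ^ (2 * e ∸ 1))
theorem1p1 (suc (suc e′)) (s≤s (s≤s z≤n)) K (N , K-finite) J three (suc (suc p′)) K/J-size =
  DivisibleDesignGraph.isDDG K N K-finite J three p′ e′ K/J-size
theorem1p1 (suc (suc e′)) (s≤s (s≤s z≤n)) K (N , K-finite) J three 0 K/J-size =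
  ⊥-elim (absurd (ThreeIdealRingCounts.2≤q K N K-finite J three 0 K/J-size))
  where absurd : ¬ 2 ≤ 0
        absurd ()
theorem1p1 (suc (suc e′)) (s≤s (s≤s z≤n)) K (N , K-finite) J three 1 K/J-size =
  ⊥-elim (absurd (ThreeIdealRingCounts.2≤q K N K-finite J three 1 K/J-size))
  where absurd : ¬ 2 ≤ 1
        absurd (s≤s ())
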